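{- Let $b,c$ be integers such that $\delta:=b^2-c$ is square-free and $\delta\not\equiv 1\pmod 4$. For a positive integer $d$ let $$\rho(d)=\#\{0\leq m<d:\ m^2+2bm+c\equiv 0\pmod d\},$$ and let $\chi$ be the function on positive integers given by $\chi(1)=1$ and, for $n\geq 1$, $\chi(n)=\left(\frac{\delta}{n}\right)$ (the Jacobi symbol) if $\gcd(n,2\delta)=1$, and $\chi(n)=0$ otherwise. Then for every positive integer $d$, $$\rho(d)=\sum_{lm=d}\mu^2(l)\chi(m),$$ where the sum is over pairs of positive integers $(l,m)$ with $lm=d$ and $\mu$ is the Möbius function. -}

module Defs where

open import Data.Nat as ℕ using (ℕ; zero; suc; NonZero)
open import Data.Nat.Divisibility as ℕD using (_∣?_)
open import Data.Nat.GCD using (gcd)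
open import Data.Nat.Primality using (Prime)
open import Data.Nat.Primality.Factorisation using (factorise; factors)
open import Data.Integer as ℤ using (ℤ; +_; -_; ∣_∣)
import Data.Integer.Divisibility as ℤD
open import Data.List using (List; []; _∷_; map; filter; length; upTo; concatMap; foldr)
open import Data.List.Relation.Unary.Any using (any?)
open import Data.List.Relation.Unary.AllPairs using (allPairs?)
open import Relation.Nullary using (Dec; yes; no; ¬_; ¬?)
open import Relation.Nullary.Decidable using (_×-dec_)
open import Data.Product using (_×_)
open import Relation.Binary.PropositionalEquality using (_≡_)

-- Decidability of integer divisibility (ℤ's _∣_ is ℕ's _∣_ on absolute values).
_∣ℤ?_ : (a b : ℤ) → Dec (a ℤD.∣ b)
a ∣ℤ? b = ∣ a ∣ ∣? ∣ b ∣

sumℤ : List ℤ → ℤ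
sumℤ = foldr ℤ._+_ (+ 0)

prodℤ : List ℤ → ℤ
prodℤ = foldr ℤ._*_ (+ 1)

ρ : ℤ → ℤ → ℕ → ℕ
ρ b c d = length (filter (λ m → (+ d) ∣ℤ? ((+ m) ℤ.* (+ m) ℤ.+ (+ 2) ℤ.* b ℤ.* (+ m) ℤ.+ c)) (upTo d))

legendre : ℤ → ℕ → ℤ
legendre a p with (+ p) ∣ℤ? a
... | yes _ = + 0
... | no _ with any? (λ x → (+ p) ∣ℤ? ((+ x) ℤ.* (+ x) ℤ.- a)) (upTo p)
...   | yes _ = + 1
...   | no _ = - (+ 1)

jacobi : ℤ → (n : ℕ) → .{{NonZero n}} → ℤ
jacobi a n = prodℤ (map (legendre a) (factors (factorise n)))

möbius : (n : ℕ) → .{{NonZero n}} → ℤ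
möbius n with allPairs? (λ x y → ¬? (x ℕ.≟ y)) (factors (factorise n))
... | yes _ = foldr (λ _ r → - r) (+ 1) (factors (factorise n))
... | no _ = + 0

χ : ℤ → (n : ℕ) → .{{NonZero n}} → ℤ
χ δ n with gcd n (2 ℕ.* ∣ δ ∣) ℕ.≟ 1
... | yes _ = jacobi δ n
... | no _ = + 0

-- Square-free integer: no square of a prime divides it (so 0 is not square-free).
SquareFree : ℤ → Set
SquareFree δ = ∀ p → Prime p → ¬ ((+ (p ℕ.* p)) ℤD.∣ δ)

sumOverFactorPairs : (d : ℕ) → ((l m : ℕ) → .{{NonZero l}} → .{{NonZero m}} → ℤ) → ℤ
sumOverFactorPairs d f =
  sumℤ (concatMap (λ i → map (λ j → term (suc i) (suc j)) (upTo d)) (upTo d))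
  where
  term : (l m : ℕ) → .{{NonZero l}} → .{{NonZero m}} → ℤ
  term l m with l ℕ.* m ℕ.≟ d
  ... | yes _ = f l m
  ... | no _ = + 0

-- Both sides are multiplicative in d, so they agree once they agree on prime powers p^(k+1).
-- Completing the square, ρ(d) counts the square roots of δ modulo d, and this count is
-- multiplicative by the Chinese remainder theorem. On the other side, since χ is completely
-- multiplicative, Σ_{lm=p^(k+1)} μ²(l)χ(m) = χ(p^(k+1)) + χ(p^k). If p ∤ 2δ this is 2 or 0 according
-- as δ is a square mod p, matching the roots ±r obtained by Hensel lifting. If p ∣ 2δ it is 1 for
-- k = 0 and 0 otherwise: there is a single root mod p, and none mod p² (δ square-free) or mod 4
-- (δ ≢ 1 mod 4).
module Submission where

open import Defs
open import Data.Nat as ℕ using (ℕ; zero; suc; NonZero; _<_; _≤_; s≤s)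
import Data.Nat.Properties as ℕ
open import Data.Nat.Divisibility as ℕ using (divides) renaming (_∣_ to _∣ℕ_)
open import Data.Nat.Coprimality as Coprime using (Coprime; coprime-Bézout)
open import Data.Nat.GCD using (gcd; module Bézout)
open import Data.Nat.Primality
  using (Prime; euclidsLemma; prime⇒irreducible; prime⇒nonZero; prime⇒nonTrivial; prime[2]; ¬prime[1])
open import Data.Nat.Primality.Factorisation using (PrimeFactorisation; factorise; factors; factorisationUnique; primeFactorisation[p])
open import Data.Nat.ListAction using (product)
open import Data.Nat.ListAction.Properties using (product-++; ∈⇒∣product)
open import Data.Nat.Induction using (<-rec)
open import Data.Integer as ℤ using (ℤ; +_; -_; _+_; _-_; _*_; ∣_∣)
import Data.Integer.Properties as ℤ
import Data.Integer.Coprimality as ℤCoprime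
open import Data.Integer.Divisibility using (_∣_)
import Data.Integer.Divisibility.Signed as Signed
open import Data.Nat.DivMod using (_/_; *-/-assoc; m*n/m*o≡n/o; m*n/n≡m)
open import Data.Integer.DivMod using (_%ℕ_; _/ℕ_; a≡a%ℕn+[a/ℕn]*n; n%ℕd<d)
open import Data.Integer.Tactic.RingSolver using (solve-∀)
open import Data.List using (List; []; _∷_; _++_; map; filter; length; upTo; concatMap; cartesianProduct; foldr)
open import Data.List.Properties using (length-++; length-map; map-++; map-∘)
open import Data.List.Membership.Propositional using (_∈_; lose)
open import Data.List.Membership.Propositional.Properties
  using (∈-filter⁺; ∈-filter⁻; ∈-upTo⁺; ∈-upTo⁻; ∈-map⁺; ∈-map⁻; ∈-++⁺ˡ; ∈-++⁺ʳ; ∈-++⁻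
        ; ∈-cartesianProduct⁺; ∈-cartesianProduct⁻)
open import Data.List.Membership.Propositional.Properties.WithK using (unique∧set⇒bag)
open import Data.List.Relation.Binary.BagAndSetEquality using (∼bag⇒↭)
open import Data.List.Relation.Binary.Permutation.Propositional using (_↭_; prep; ↭-sym; ↭-trans; ↭⇒↭ₛ)
open import Data.List.Relation.Binary.Permutation.Propositional.Properties using (↭-length; ++⁺ʳ; map⁺)
open import Data.List.Relation.Binary.Permutation.Setoid.Properties using (foldr-commMonoid; Unique-resp-↭)
open import Data.List.Relation.Unary.All as All using (All; []; _∷_)
import Data.List.Relation.Unary.All.Properties as All
open import Data.List.Relation.Unary.AllPairs as AllPairs using (AllPairs; []; _∷_; allPairs?)
import Data.List.Relation.Unary.AllPairs.Properties as AllPairs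
open import Data.List.Relation.Unary.Any as Any using (Any; here; there; any?)
import Data.List.Relation.Unary.Any.Properties as Any
open import Data.List.Relation.Unary.Unique.Propositional using (Unique)
open import Data.List.Relation.Unary.Unique.DecPropositional ℕ._≟_ using (unique?)
import Data.List.Relation.Unary.Unique.Propositional.Properties as Unique
open import Data.Product using (∃; ∃₂; _×_; _,_; proj₁; proj₂; uncurry)
open import Data.Bool using (true; false; if_then_else_)
open import Data.Empty using (⊥-elim)
open import Data.Sum as Sum using (_⊎_; inj₁; inj₂; [_,_]′)
open import Function using (_∘_; id; flip; case_of_)
open import Function.Bundles using (mk⇔)
open import Relation.Nullary using (¬_; ¬?; Dec; yes; no; does; contradiction)
open import Relation.Nullary.Decidable using (dec-true; dec-false)
open import Relation.Unary using (Decidable)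
open import Relation.Binary.Bundles using (Setoid)
import Relation.Binary.Reasoning.Setoid as SetoidReasoning
open import Relation.Binary.PropositionalEquality
  using (_≡_; _≢_; refl; sym; trans; cong; cong₂; subst; setoid; module ≡-Reasoning)

private
  variable
    A B : Set

-- Counting and summing over lists

length-filter-upTo : ∀ {P : ℕ → Set} (P? : Decidable P) n (xs : List ℕ) → Unique xs →
  (∀ {x} → x ∈ xs → x < n × P x) → (∀ {x} → x < n → P x → x ∈ xs) →
  length (filter P? (upTo n)) ≡ length xs
length-filter-upTo P? n xs xs! sound complete =
  ↭-length (∼bag⇒↭ (unique∧set⇒bag (Unique.filter⁺ P? (Unique.upTo⁺ n)) xs! (mk⇔ to from)))
  where
  to : ∀ {x} → x ∈ filter P? (upTo n) → x ∈ xs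
  to x∈ with ∈-filter⁻ P? x∈
  ... | x∈upTo , px = complete (∈-upTo⁻ x∈upTo) px
  from : ∀ {x} → x ∈ xs → x ∈ filter P? (upTo n)
  from x∈ with sound x∈
  ... | x<n , px = ∈-filter⁺ P? (∈-upTo⁺ x<n) px

Unique-map⁺ : ∀ (f : A → B) {xs} → Unique xs →
  (∀ {x y} → x ∈ xs → y ∈ xs → f x ≡ f y → x ≡ y) → Unique (map f xs)
Unique-map⁺ f [] inj = []
Unique-map⁺ f (x∉xs ∷ xs!) inj =
  All.map⁺ (All.tabulate λ y∈ fx≡fy → All.lookup x∉xs y∈ (inj (here refl) (there y∈) fx≡fy))
  ∷ Unique-map⁺ f xs! (λ x∈ y∈ → inj (there x∈) (there y∈))

length-cartesianProduct : (xs : List A) (ys : List B) →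
  length (cartesianProduct xs ys) ≡ length xs ℕ.* length ys
length-cartesianProduct [] ys = refl
length-cartesianProduct (x ∷ xs) ys = begin
  length (map (x ,_) ys ++ cartesianProduct xs ys)    ≡⟨ length-++ (map (x ,_) ys) ⟩
  length (map (x ,_) ys) ℕ.+ length (cartesianProduct xs ys)
    ≡⟨ cong₂ ℕ._+_ (length-map (x ,_) ys) (length-cartesianProduct xs ys) ⟩
  length ys ℕ.+ length xs ℕ.* length ys               ∎
  where open ≡-Reasoning

sumℤ-++ : ∀ xs ys → sumℤ (xs ++ ys) ≡ sumℤ xs + sumℤ ys
sumℤ-++ [] ys = sym (ℤ.+-identityˡ _)
sumℤ-++ (x ∷ xs) ys = trans (cong (λ t → x + t) (sumℤ-++ xs ys)) (sym (ℤ.+-assoc x _ _))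

sumℤ-↭ : ∀ {xs ys} → xs ↭ ys → sumℤ xs ≡ sumℤ ys
sumℤ-↭ p = foldr-commMonoid (setoid ℤ) ℤ.+-0-isCommutativeMonoid (↭⇒↭ₛ p)

sumℤ-concatMap : (f : A → List ℤ) (xs : List A) → sumℤ (concatMap f xs) ≡ sumℤ (map (λ x → sumℤ (f x)) xs)
sumℤ-concatMap f [] = refl
sumℤ-concatMap f (x ∷ xs) = trans (sumℤ-++ (f x) (concatMap f xs)) (cong (λ t → sumℤ (f x) + t) (sumℤ-concatMap f xs))

sumℤ-map-cong : ∀ {f g : A → ℤ} xs → (∀ {x} → x ∈ xs → f x ≡ g x) → sumℤ (map f xs) ≡ sumℤ (map g xs)
sumℤ-map-cong [] eq = refl
sumℤ-map-cong (x ∷ xs) eq = cong₂ _+_ (eq (here refl)) (sumℤ-map-cong xs (eq ∘ there))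

sumℤ-map-zero : ∀ (f : A → ℤ) xs → (∀ {x} → x ∈ xs → f x ≡ + 0) → sumℤ (map f xs) ≡ + 0
sumℤ-map-zero f xs eq = trans (sumℤ-map-cong xs eq) (zeros xs)
  where
  zeros : ∀ (xs : List A) → sumℤ (map (λ _ → + 0) xs) ≡ + 0
  zeros [] = refl
  zeros (_ ∷ xs) = trans (ℤ.+-identityˡ _) (zeros xs)

sumℤ-map-single : ∀ (f : A → ℤ) {xs x₀} → Unique xs → x₀ ∈ xs →
  (∀ {x} → x ∈ xs → x ≢ x₀ → f x ≡ + 0) → sumℤ (map f xs) ≡ f x₀
sumℤ-map-single f (x∉xs ∷ xs!) (here refl) others =
  trans (cong (λ t → f _ + t) (sumℤ-map-zero f _ λ y∈ → others (there y∈) λ { refl → All.lookup x∉xs y∈ refl }))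
        (ℤ.+-identityʳ _)
sumℤ-map-single f (x∉xs ∷ xs!) (there x₀∈) others =
  trans (cong₂ _+_ (others (here refl) λ { refl → All.lookup x∉xs x₀∈ refl })
                   (sumℤ-map-single f xs! x₀∈ λ y∈ → others (there y∈)))
        (ℤ.+-identityˡ _)

sumℤ-map-*ˡ : ∀ c (f : A → ℤ) xs → sumℤ (map (λ x → c * f x) xs) ≡ c * sumℤ (map f xs)
sumℤ-map-*ˡ c f [] = sym (ℤ.*-zeroʳ c)
sumℤ-map-*ˡ c f (x ∷ xs) = trans (cong (λ t → c * f x + t) (sumℤ-map-*ˡ c f xs)) (sym (ℤ.*-distribˡ-+ c (f x) _))

sumℤ-map-filter : ∀ {P : A → Set} (P? : Decidable P) (f : A → ℤ) xs →
  sumℤ (map f (filter P? xs)) ≡ sumℤ (map (λ x → if does (P? x) then f x else + 0) xs)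
sumℤ-map-filter P? f [] = refl
sumℤ-map-filter P? f (x ∷ xs) with does (P? x)
... | true = cong (λ t → f x + t) (sumℤ-map-filter P? f xs)
... | false = trans (sumℤ-map-filter P? f xs) (sym (ℤ.+-identityˡ _))

-- Divisibility and congruences

prime∣*⇒∣⊎∣ : ∀ {p} → Prime p → ∀ m n → + p ∣ m * n → (+ p ∣ m) ⊎ (+ p ∣ n)
prime∣*⇒∣⊎∣ p-prime m n p∣mn = euclidsLemma ∣ m ∣ ∣ n ∣ p-prime (subst (_ ∣ℕ_) (ℤ.abs-* m n) p∣mn)

coprime∧∣*⇒∣ : ∀ {n} m k → Coprime n ∣ m ∣ → + n ∣ m * k → + n ∣ k
coprime∧∣*⇒∣ {n} = ℤCoprime.coprime-divisor (+ n)

prime∤⇒coprime : ∀ {p a} → Prime p → ¬ p ∣ℕ a → Coprime p a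
prime∤⇒coprime p-prime p∤a (d∣p , d∣a) with prime⇒irreducible p-prime d∣p
... | inj₁ d≡1 = d≡1
... | inj₂ refl = contradiction d∣a p∤a

∤⇒nonZero : ∀ {p m} → ¬ p ∣ℕ m → NonZero m
∤⇒nonZero {p} p∤m = ℕ.≢-nonZero (λ { refl → p∤m (p ℕ.∣0) })

coprime-* : ∀ {a b c} → Coprime a c → Coprime b c → Coprime (a ℕ.* b) c
coprime-* a⊥c b⊥c (d∣ab , d∣c) =
  b⊥c (Coprime.coprime-divisor (λ (e∣d , e∣a) → a⊥c (e∣a , ℕ.∣-trans e∣d d∣c)) d∣ab , d∣c)

coprime-^ : ∀ {a c} → Coprime a c → ∀ k → Coprime (a ℕ.^ k) c
coprime-^ a⊥c zero (d∣1 , _) = ℕ.∣1⇒≡1 d∣1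
coprime-^ a⊥c (suc k) = coprime-* a⊥c (coprime-^ a⊥c k)

coprime-*⁻ˡ : ∀ {a b c} → Coprime (a ℕ.* b) c → Coprime a c
coprime-*⁻ˡ {b = b} ab⊥c (d∣a , d∣c) = ab⊥c (ℕ.∣m⇒∣m*n b d∣a , d∣c)

coprime-*⁻ʳ : ∀ {a b c} → Coprime (a ℕ.* b) c → Coprime b c
coprime-*⁻ʳ {a} ab⊥c (d∣b , d∣c) = ab⊥c (ℕ.∣n⇒∣m*n a d∣b , d∣c)

coprime∧∣∧∣⇒*∣ : ∀ {a b n} → Coprime a b → a ∣ℕ n → b ∣ℕ n → a ℕ.* b ∣ℕ n
coprime∧∣∧∣⇒*∣ {a} {b} a⊥b (divides q n≡qa) b∣n = divides (ℕ.quotient b∣q) (begin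
  _                              ≡⟨ n≡qa ⟩
  q ℕ.* a                        ≡⟨ cong (ℕ._* a) (ℕ._∣_.equality b∣q) ⟩
  ℕ.quotient b∣q ℕ.* b ℕ.* a     ≡⟨ ℕ.*-assoc (ℕ.quotient b∣q) b a ⟩
  ℕ.quotient b∣q ℕ.* (b ℕ.* a)   ≡⟨ cong (ℕ.quotient b∣q ℕ.*_) (ℕ.*-comm b a) ⟩
  ℕ.quotient b∣q ℕ.* (a ℕ.* b)   ∎)
  where
  open ≡-Reasoning
  b∣q : b ∣ℕ q
  b∣q = Coprime.coprime-divisor (Coprime.sym a⊥b) (subst (b ∣ℕ_) (trans n≡qa (ℕ.*-comm q a)) b∣n)

infix 4 _≡_mod_
record _≡_mod_ (x y : ℤ) (n : ℕ) : Set where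
  constructor ≡-mod
  field ∣-diff : + n Signed.∣ x - y

≡-mod-≡ : ∀ {n x x′ y y′} → x ≡ x′ → y ≡ y′ → x ≡ y mod n → x′ ≡ y′ mod n
≡-mod-≡ refl refl x≡y = x≡y

≡-mod-refl : ∀ {n} x → x ≡ x mod n
≡-mod-refl x = ≡-mod (Signed.divides (+ 0) (ℤ.+-inverseʳ x))

≡-mod-sym : ∀ {n x y} → x ≡ y mod n → y ≡ x mod n
≡-mod-sym {x = x} {y} (≡-mod n∣x-y) = ≡-mod (subst (_ Signed.∣_) (identity x y) (Signed.∣m⇒∣-m n∣x-y))
  where
  identity : ∀ x y → - (x - y) ≡ y - x
  identity = solve-∀

≡-mod-trans : ∀ {n x y z} → x ≡ y mod n → y ≡ z mod n → x ≡ z mod n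
≡-mod-trans {x = x} {y} {z} (≡-mod n∣x-y) (≡-mod n∣y-z) =
  ≡-mod (subst (_ Signed.∣_) (identity x y z) (Signed.∣m∣n⇒∣m+n n∣x-y n∣y-z))
  where
  identity : ∀ x y z → (x - y) + (y - z) ≡ x - z
  identity = solve-∀

≡-mod-+ : ∀ {n x x′ y y′} → x ≡ x′ mod n → y ≡ y′ mod n → x + y ≡ x′ + y′ mod n
≡-mod-+ {x = x} {x′} {y} {y′} (≡-mod n∣x-x′) (≡-mod n∣y-y′) =
  ≡-mod (subst (_ Signed.∣_) (identity x x′ y y′) (Signed.∣m∣n⇒∣m+n n∣x-x′ n∣y-y′))
  where
  identity : ∀ x x′ y y′ → (x - x′) + (y - y′) ≡ x + y - (x′ + y′)
  identity = solve-∀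

≡-mod-* : ∀ {n x x′ y y′} → x ≡ x′ mod n → y ≡ y′ mod n → x * y ≡ x′ * y′ mod n
≡-mod-* {x = x} {x′} {y} {y′} (≡-mod n∣x-x′) (≡-mod n∣y-y′) =
  ≡-mod (subst (_ Signed.∣_) (identity x x′ y y′)
    (Signed.∣m∣n⇒∣m+n (Signed.∣m⇒∣m*n y n∣x-x′) (Signed.∣n⇒∣m*n x′ n∣y-y′)))
  where
  identity : ∀ x x′ y y′ → (x - x′) * y + x′ * (y - y′) ≡ x * y - x′ * y′
  identity = solve-∀

≡-mod-setoid : ℕ → Setoid _ _
≡-mod-setoid n = record
  { Carrier = ℤ
  ; _≈_ = λ x y → x ≡ y mod n
  ; isEquivalence = record { refl = ≡-mod-refl _ ; sym = ≡-mod-sym ; trans = ≡-mod-trans }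
  }

module ≡-mod-Reasoning (n : ℕ) = SetoidReasoning (≡-mod-setoid n)

x*n≡0-mod : ∀ {n} x → x * + n ≡ + 0 mod n
x*n≡0-mod x = ≡-mod (Signed.divides x (ℤ.+-identityʳ _))

∣⇒≡-mod-0 : ∀ {n x} → + n ∣ x → x ≡ + 0 mod n
∣⇒≡-mod-0 {x = x} n∣x = ≡-mod (subst (_ Signed.∣_) (sym (ℤ.+-identityʳ x)) (Signed.∣ᵤ⇒∣ n∣x))

≡-mod-0⇒∣ : ∀ {n x} → x ≡ + 0 mod n → + n ∣ x
≡-mod-0⇒∣ {n} {x} (≡-mod n∣x-0) = subst (+ n ∣_) (ℤ.+-identityʳ x) (Signed.∣⇒∣ᵤ n∣x-0)

quotient⇒≡-mod-0 : ∀ {n x} q → x ≡ q * + n → x ≡ + 0 mod n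
quotient⇒≡-mod-0 {x = x} q x≡qn = ≡-mod (Signed.divides q (trans (ℤ.+-identityʳ x) x≡qn))

≡-mod-0⇒quotient : ∀ {n x} → x ≡ + 0 mod n → ∃ λ q → x ≡ q * + n
≡-mod-0⇒quotient {x = x} (≡-mod (Signed.divides q x-0≡qn)) = q , trans (sym (ℤ.+-identityʳ x)) x-0≡qn

≡-mod-∣ : ∀ {d n x y} → d ∣ℕ n → x ≡ y mod n → x ≡ y mod d
≡-mod-∣ d∣n (≡-mod n∣x-y) = ≡-mod (Signed.∣-trans (Signed.∣ᵤ⇒∣ d∣n) n∣x-y)

≡-mod-coprime-* : ∀ {a b x y} → Coprime a b → x ≡ y mod a → x ≡ y mod b → x ≡ y mod a ℕ.* b
≡-mod-coprime-* a⊥b (≡-mod a∣x-y) (≡-mod b∣x-y) =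
  ≡-mod (Signed.∣ᵤ⇒∣ (coprime∧∣∧∣⇒*∣ a⊥b (Signed.∣⇒∣ᵤ a∣x-y) (Signed.∣⇒∣ᵤ b∣x-y)))

%ℕ-≡-mod : ∀ x n .{{_ : NonZero n}} → + (x %ℕ n) ≡ x mod n
%ℕ-≡-mod x n = ≡-mod (Signed.divides (- (x /ℕ n)) (lemma (+ (x %ℕ n)) (x /ℕ n) x (a≡a%ℕn+[a/ℕn]*n x n)))
  where
  lemma : ∀ r q x → x ≡ r + q * + n → r - x ≡ - q * + n
  lemma r q x refl = identity r q (+ n)
    where
    identity : ∀ r q n → r - (r + q * n) ≡ - q * n
    identity = solve-∀

∣∧<⇒≡0 : ∀ {m n} → n ∣ℕ m → m < n → m ≡ 0
∣∧<⇒≡0 {zero} _ _ = refl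
∣∧<⇒≡0 {suc m} n∣m m<n = contradiction n∣m (ℕ.>⇒∤ m<n)

≤∧≡-mod⇒≡ : ∀ {n x y} → x ≤ y → y < n → + x ≡ + y mod n → x ≡ y
≤∧≡-mod⇒≡ {n} {x} {y} x≤y y<n (≡-mod n∣x-y) =
  ℕ.≤-antisym x≤y (ℕ.m∸n≡0⇒m≤n (∣∧<⇒≡0 n∣y∸x y∸x<n))
  where
  n∣y∸x : n ∣ℕ y ℕ.∸ x
  n∣y∸x = subst (n ∣ℕ_) (trans (cong ∣_∣ (ℤ.[+m]-[+n]≡m⊖n x y)) (ℤ.∣⊖∣-≤ x≤y))
    (Signed.∣⇒∣ᵤ n∣x-y)
  y∸x<n : y ℕ.∸ x < n
  y∸x<n = ℕ.≤-<-trans (ℕ.m∸n≤m y x) y<n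

≡-mod⇒≡ : ∀ {n x y} → x < n → y < n → + x ≡ + y mod n → x ≡ y
≡-mod⇒≡ {x = x} {y} x<n y<n x≡y with ℕ.≤-total x y
... | inj₁ x≤y = ≤∧≡-mod⇒≡ x≤y y<n x≡y
... | inj₂ y≤x = sym (≤∧≡-mod⇒≡ y≤x x<n (≡-mod-sym x≡y))

bézout : ∀ {a b} → Coprime a b → ∃₂ λ u v → u * + a + v * + b ≡ + 1
bézout {a} {b} a⊥b = fromℕ (coprime-Bézout a⊥b)
  where
  cast : ∀ m n r s → 1 ℕ.+ m ℕ.* n ≡ r ℕ.* s → + 1 + + m * + n ≡ + r * + s
  cast m n r s eq = trans (cong (λ t → + 1 + t) (sym (ℤ.pos-* m n))) (trans (cong +_ eq) (ℤ.pos-* r s))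
  cancelʳ : ∀ x y → + 1 + x * y + (- x) * y ≡ + 1
  cancelʳ = solve-∀
  cancelˡ : ∀ x y → - x * y + (+ 1 + x * y) ≡ + 1
  cancelˡ = solve-∀
  fromℕ : Bézout.Identity 1 a b → ∃₂ λ u v → u * + a + v * + b ≡ + 1
  fromℕ (Bézout.+- x y eq) = + x , - + y , trans (cong (λ t → t + - + y * + b) (sym (cast y b x a eq))) (cancelʳ (+ y) (+ b))
  fromℕ (Bézout.-+ x y eq) = - + x , + y , trans (cong (λ t → - + x * + a + t) (sym (cast x a y b eq))) (cancelˡ (+ x) (+ a))

inverse-mod : ∀ {n} x → Coprime n ∣ x ∣ → ∃ λ w → w * x ≡ + 1 mod n
inverse-mod {n} x n⊥x with bézout n⊥x
... | u , v , un+v∣x∣≡1 = w , ≡-mod (Signed.divides (- u) w*x-1≡-un)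
  where
  open ≡-Reasoning
  absorb-sign : ∃ λ w → w * x ≡ v * + ∣ x ∣
  absorb-sign with ℤ.+∣i∣≡i⊎+∣i∣≡-i x
  ... | inj₁ ∣x∣≡x = v , cong (v *_) (sym ∣x∣≡x)
  ... | inj₂ ∣x∣≡-x = - v , trans (trans (sym (ℤ.neg-distribˡ-* v x)) (ℤ.neg-distribʳ-* v x))
                                 (cong (v *_) (sym ∣x∣≡-x))
  w : ℤ
  w = proj₁ absorb-sign
  identity : ∀ u v n a → v * a - (u * n + v * a) ≡ - u * n
  identity = solve-∀
  w*x-1≡-un : w * x - + 1 ≡ - u * + n
  w*x-1≡-un = begin
    w * x - + 1                            ≡⟨ cong₂ _-_ (proj₂ absorb-sign) (sym un+v∣x∣≡1) ⟩
    v * + ∣ x ∣ - (u * + n + v * + ∣ x ∣)  ≡⟨ identity u v (+ n) (+ ∣ x ∣) ⟩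
    - u * + n                              ∎

-- Counting roots modulo n

rootCount : (ℤ → ℤ) → ℕ → ℕ
rootCount g n = length (filter (λ m → (+ n) ∣ℤ? g (+ m)) (upTo n))

PreservesCongruence : (ℤ → ℤ) → Set
PreservesCongruence g = ∀ {n x y} → x ≡ y mod n → g x ≡ g y mod n

record RootsMod (g : ℤ → ℤ) (n : ℕ) (rs : List ℤ) : Set where
  field
    incongruent : AllPairs (λ r s → ¬ r ≡ s mod n) rs
    roots       : All (λ r → g r ≡ + 0 mod n) rs
    complete    : ∀ x → g x ≡ + 0 mod n → Any (λ r → x ≡ r mod n) rs

module _ {g : ℤ → ℤ} (g-cong : PreservesCongruence g) where

  root-≡-mod : ∀ {n x y} → x ≡ y mod n → g y ≡ + 0 mod n → g x ≡ + 0 mod n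
  root-≡-mod x≡y = ≡-mod-trans (g-cong x≡y)

  rootCount-RootsMod : ∀ {n rs} .{{_ : NonZero n}} → RootsMod g n rs → rootCount g n ≡ length rs
  rootCount-RootsMod {n} {rs} R = trans
    (length-filter-upTo (λ m → (+ n) ∣ℤ? g (+ m)) n (map residue rs) residues-unique sound covering)
    (length-map residue rs)
    where
    open RootsMod R
    residue : ℤ → ℕ
    residue r = r %ℕ n
    residues-unique : Unique (map residue rs)
    residues-unique = AllPairs.map⁺ (AllPairs.map (λ {r} {s} r≢s r≡s → r≢s (≡-mod-trans
      (≡-mod-sym (%ℕ-≡-mod r n)) (subst (λ t → + t ≡ s mod n) (sym r≡s) (%ℕ-≡-mod s n)))) incongruent)
    sound : ∀ {x} → x ∈ map residue rs → x < n × + n ∣ g (+ x)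
    sound x∈ with ∈-map⁻ residue x∈
    ... | r , r∈rs , refl = n%ℕd<d r n , ≡-mod-0⇒∣ (root-≡-mod (%ℕ-≡-mod r n) (All.lookup roots r∈rs))
    covering : ∀ {x} → x < n → + n ∣ g (+ x) → x ∈ map residue rs
    covering {x} x<n n∣gx = Any.map⁺ (Any.map (λ {r} x≡r → ≡-mod⇒≡ x<n (n%ℕd<d r n)
      (≡-mod-trans x≡r (≡-mod-sym (%ℕ-≡-mod r n)))) (complete (+ x) (∣⇒≡-mod-0 n∣gx)))

module ChineseRemainder {a b : ℕ} .{{_ : NonZero a}} .{{_ : NonZero b}} (a⊥b : Coprime a b) where

  instance
    ab≢0 : NonZero (a ℕ.* b)
    ab≢0 = ℕ.m*n≢0 a b

  u v : ℤ
  u = proj₁ (bézout a⊥b)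
  v = proj₁ (proj₂ (bézout a⊥b))

  ua+vb≡1 : u * + a + v * + b ≡ + 1
  ua+vb≡1 = proj₂ (proj₂ (bézout a⊥b))

  lift : ℤ → ℤ → ℤ
  lift x y = x * (v * + b) + y * (u * + a)

  lift-≡ˡ : ∀ x y → lift x y ≡ x mod a
  lift-≡ˡ x y = begin
    lift x y                                     ≡⟨ identity x y u v (+ a) (+ b) ⟩
    x * (u * + a + v * + b) + (y - x) * u * + a
      ≈⟨ ≡-mod-+ (≡-mod-refl (x * (u * + a + v * + b))) (x*n≡0-mod ((y - x) * u)) ⟩
    x * (u * + a + v * + b) + + 0                ≡⟨ cong (λ t → x * t + + 0) ua+vb≡1 ⟩
    x * + 1 + + 0                                ≡⟨ trans (ℤ.+-identityʳ _) (ℤ.*-identityʳ x) ⟩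
    x                                            ∎
    where
    open ≡-mod-Reasoning a
    identity : ∀ x y u v a b → x * (v * b) + y * (u * a) ≡ x * (u * a + v * b) + (y - x) * u * a
    identity = solve-∀

  lift-≡ʳ : ∀ x y → lift x y ≡ y mod b
  lift-≡ʳ x y = begin
    lift x y                                     ≡⟨ identity x y u v (+ a) (+ b) ⟩
    y * (u * + a + v * + b) + (x - y) * v * + b
      ≈⟨ ≡-mod-+ (≡-mod-refl (y * (u * + a + v * + b))) (x*n≡0-mod ((x - y) * v)) ⟩
    y * (u * + a + v * + b) + + 0                ≡⟨ cong (λ t → y * t + + 0) ua+vb≡1 ⟩
    y * + 1 + + 0                                ≡⟨ trans (ℤ.+-identityʳ _) (ℤ.*-identityʳ y) ⟩
    y                                            ∎
    where
    open ≡-mod-Reasoning b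
    identity : ∀ x y u v a b → x * (v * b) + y * (u * a) ≡ y * (u * a + v * b) + (x - y) * v * b
    identity = solve-∀

  combine : ℕ → ℕ → ℕ
  combine x y = lift (+ x) (+ y) %ℕ (a ℕ.* b)

  combine-≡ˡ : ∀ x y → + combine x y ≡ + x mod a
  combine-≡ˡ x y = ≡-mod-trans (≡-mod-∣ (ℕ.m∣m*n b) (%ℕ-≡-mod _ (a ℕ.* b))) (lift-≡ˡ (+ x) (+ y))

  combine-≡ʳ : ∀ x y → + combine x y ≡ + y mod b
  combine-≡ʳ x y = ≡-mod-trans (≡-mod-∣ (ℕ.n∣m*n a) (%ℕ-≡-mod _ (a ℕ.* b))) (lift-≡ʳ (+ x) (+ y))

  module _ {g : ℤ → ℤ} (g-cong : PreservesCongruence g) where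

    rootsBelow : (n : ℕ) → List ℕ
    rootsBelow n = filter (λ m → (+ n) ∣ℤ? g (+ m)) (upTo n)

    ∈-rootsBelow⁻ : ∀ {n x} → x ∈ rootsBelow n → x < n × g (+ x) ≡ + 0 mod n
    ∈-rootsBelow⁻ {n} x∈ with ∈-filter⁻ (λ m → (+ n) ∣ℤ? g (+ m)) {xs = upTo n} x∈
    ... | x∈upTo , n∣gx = ∈-upTo⁻ x∈upTo , ∣⇒≡-mod-0 n∣gx

    ∈-rootsBelow⁺ : ∀ {n x} → x < n → g (+ x) ≡ + 0 mod n → x ∈ rootsBelow n
    ∈-rootsBelow⁺ {n} x<n gx≡0 = ∈-filter⁺ (λ m → (+ n) ∣ℤ? g (+ m)) (∈-upTo⁺ x<n) (≡-mod-0⇒∣ gx≡0)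

    rootsBelow-unique : ∀ n → Unique (rootsBelow n)
    rootsBelow-unique n = Unique.filter⁺ (λ m → (+ n) ∣ℤ? g (+ m)) (Unique.upTo⁺ n)

    combinedRoots : List ℕ
    combinedRoots = map (uncurry combine) (cartesianProduct (rootsBelow a) (rootsBelow b))

    combine-injective : ∀ {p q} → p ∈ cartesianProduct (rootsBelow a) (rootsBelow b) →
      q ∈ cartesianProduct (rootsBelow a) (rootsBelow b) → uncurry combine p ≡ uncurry combine q → p ≡ q
    combine-injective {x , y} {x′ , y′} p∈ q∈ eq
      with ∈-cartesianProduct⁻ (rootsBelow a) (rootsBelow b) p∈ | ∈-cartesianProduct⁻ (rootsBelow a) (rootsBelow b) q∈
    ... | x∈ , y∈ | x′∈ , y′∈ = cong₂ _,_
      (≡-mod⇒≡ (proj₁ (∈-rootsBelow⁻ x∈)) (proj₁ (∈-rootsBelow⁻ x′∈))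
        (≡-mod-trans (≡-mod-sym (combine-≡ˡ x y)) (subst (λ t → + t ≡ + x′ mod a) (sym eq) (combine-≡ˡ x′ y′))))
      (≡-mod⇒≡ (proj₁ (∈-rootsBelow⁻ y∈)) (proj₁ (∈-rootsBelow⁻ y′∈))
        (≡-mod-trans (≡-mod-sym (combine-≡ʳ x y)) (subst (λ t → + t ≡ + y′ mod b) (sym eq) (combine-≡ʳ x′ y′))))

    combinedRoots-sound : ∀ {z} → z ∈ combinedRoots → z < a ℕ.* b × + (a ℕ.* b) ∣ g (+ z)
    combinedRoots-sound z∈ with ∈-map⁻ (uncurry combine) z∈
    ... | (x , y) , p∈ , refl with ∈-cartesianProduct⁻ (rootsBelow a) (rootsBelow b) p∈
    ...   | x∈ , y∈ = n%ℕd<d (lift (+ x) (+ y)) (a ℕ.* b) , ≡-mod-0⇒∣ (≡-mod-coprime-* a⊥b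
            (root-≡-mod g-cong (combine-≡ˡ x y) (proj₂ (∈-rootsBelow⁻ x∈)))
            (root-≡-mod g-cong (combine-≡ʳ x y) (proj₂ (∈-rootsBelow⁻ y∈))))

    combinedRoots-complete : ∀ {z} → z < a ℕ.* b → + (a ℕ.* b) ∣ g (+ z) → z ∈ combinedRoots
    combinedRoots-complete {z} z<ab ab∣gz =
      subst (_∈ combinedRoots) combine≡z (∈-map⁺ (uncurry combine) (∈-cartesianProduct⁺ x∈ y∈))
      where
      x y : ℕ
      x = + z %ℕ a
      y = + z %ℕ b
      gz≡0 : g (+ z) ≡ + 0 mod a ℕ.* b
      gz≡0 = ∣⇒≡-mod-0 ab∣gz
      x∈ : x ∈ rootsBelow a
      x∈ = ∈-rootsBelow⁺ (n%ℕd<d (+ z) a) (root-≡-mod g-cong (%ℕ-≡-mod (+ z) a) (≡-mod-∣ (ℕ.m∣m*n b) gz≡0))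
      y∈ : y ∈ rootsBelow b
      y∈ = ∈-rootsBelow⁺ (n%ℕd<d (+ z) b) (root-≡-mod g-cong (%ℕ-≡-mod (+ z) b) (≡-mod-∣ (ℕ.n∣m*n a) gz≡0))
      combine≡z : combine x y ≡ z
      combine≡z = ≡-mod⇒≡ (n%ℕd<d (lift (+ x) (+ y)) (a ℕ.* b)) z<ab (≡-mod-coprime-* a⊥b
        (≡-mod-trans (combine-≡ˡ x y) (%ℕ-≡-mod (+ z) a))
        (≡-mod-trans (combine-≡ʳ x y) (%ℕ-≡-mod (+ z) b)))

    combinedRoots-unique : Unique combinedRoots
    combinedRoots-unique = Unique-map⁺ (uncurry combine)
      (Unique.cartesianProduct⁺ (rootsBelow-unique a) (rootsBelow-unique b)) combine-injective

    rootCount-* : rootCount g (a ℕ.* b) ≡ rootCount g a ℕ.* rootCount g b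
    rootCount-* = begin
      rootCount g (a ℕ.* b)
        ≡⟨ length-filter-upTo (λ m → (+ (a ℕ.* b)) ∣ℤ? g (+ m)) (a ℕ.* b) combinedRoots
             combinedRoots-unique combinedRoots-sound combinedRoots-complete ⟩
      length combinedRoots
        ≡⟨ length-map (uncurry combine) (cartesianProduct (rootsBelow a) (rootsBelow b)) ⟩
      length (cartesianProduct (rootsBelow a) (rootsBelow b))
        ≡⟨ length-cartesianProduct (rootsBelow a) (rootsBelow b) ⟩
      rootCount g a ℕ.* rootCount g b
        ∎
      where open ≡-Reasoning

module _ {g : ℤ → ℤ} {n : ℕ} where

  RootsMod-none : (∀ x → ¬ g x ≡ + 0 mod n) → RootsMod g n []
  RootsMod-none no-root = record
    { incongruent = []
    ; roots = []
    ; complete = λ x gx≡0 → contradiction gx≡0 (no-root x)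
    }

  RootsMod-single : ∀ r → g r ≡ + 0 mod n → (∀ x → g x ≡ + 0 mod n → x ≡ r mod n) → RootsMod g n (r ∷ [])
  RootsMod-single r gr≡0 unique = record
    { incongruent = [] ∷ []
    ; roots = gr≡0 ∷ []
    ; complete = λ x gx≡0 → here (unique x gx≡0)
    }

  RootsMod-pair : ∀ r s → ¬ r ≡ s mod n → g r ≡ + 0 mod n → g s ≡ + 0 mod n →
    (∀ x → g x ≡ + 0 mod n → (x ≡ r mod n) ⊎ (x ≡ s mod n)) → RootsMod g n (r ∷ s ∷ [])
  RootsMod-pair r s r≢s gr≡0 gs≡0 r-or-s = record
    { incongruent = (r≢s ∷ []) ∷ [] ∷ []
    ; roots = gr≡0 ∷ gs≡0 ∷ []
    ; complete = λ x gx≡0 → [ here , there ∘ here ]′ (r-or-s x gx≡0)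
    }

-- Square roots of δ modulo prime powers

norm : ℤ → ℤ → ℤ
norm δ y = y * y - δ

norm-cong : ∀ δ → PreservesCongruence (norm δ)
norm-cong δ x≡y = ≡-mod-+ (≡-mod-* x≡y x≡y) (≡-mod-refl (- δ))

roots⇒∣* : ∀ {δ n y r} → norm δ y ≡ + 0 mod n → norm δ r ≡ + 0 mod n → + n ∣ (y - r) * (y + r)
roots⇒∣* {δ} {n} {y} {r} y-root r-root =
  subst (+ n ∣_) (identity y r δ) (Signed.∣⇒∣ᵤ (_≡_mod_.∣-diff (≡-mod-trans y-root (≡-mod-sym r-root))))
  where
  identity : ∀ y r δ → (y * y - δ) - (r * r - δ) ≡ (y - r) * (y + r)
  identity = solve-∀

∣+⇒≡-mod-neg : ∀ {n y r} → + n ∣ y + r → y ≡ - r mod n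
∣+⇒≡-mod-neg {n} {y} {r} n∣y+r = ≡-mod (subst (+ n Signed.∣_) (identity y r) (Signed.∣ᵤ⇒∣ n∣y+r))
  where
  identity : ∀ y r → y + r ≡ y - - r
  identity = solve-∀

norm≡0⇒square≡ : ∀ {δ n y} → norm δ y ≡ + 0 mod n → y * y ≡ δ mod n
norm≡0⇒square≡ {δ} {y = y} y-root = ≡-mod-≡ (identity y δ) (ℤ.+-identityˡ δ) (≡-mod-+ y-root (≡-mod-refl δ))
  where
  identity : ∀ y δ → y * y - δ + δ ≡ y * y
  identity = solve-∀

square≡⇒norm≡0 : ∀ {δ n y} → y * y ≡ δ mod n → norm δ y ≡ + 0 mod n
square≡⇒norm≡0 {δ} {y = y} y²≡δ = ≡-mod-≡ refl (ℤ.+-inverseʳ δ) (≡-mod-+ y²≡δ (≡-mod-refl (- δ)))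

≡-mod-neg⇒∣2* : ∀ {n r} → r ≡ - r mod n → + n ∣ + 2 * r
≡-mod-neg⇒∣2* {n} {r} (≡-mod n∣r--r) = subst (+ n ∣_) (identity r) (Signed.∣⇒∣ᵤ n∣r--r)
  where
  identity : ∀ r → r - - r ≡ + 2 * r
  identity = solve-∀

∣2*⇒≡-mod-neg : ∀ {n r} → + n ∣ + 2 * r → r ≡ - r mod n
∣2*⇒≡-mod-neg {n} {r} n∣2r = ≡-mod (subst (+ n Signed.∣_) (identity r) (Signed.∣ᵤ⇒∣ n∣2r))
  where
  identity : ∀ r → + 2 * r ≡ r - - r
  identity = solve-∀

roots-±-mod-prime : ∀ {p δ r} → Prime p → norm δ r ≡ + 0 mod p →
  ∀ y → norm δ y ≡ + 0 mod p → (y ≡ r mod p) ⊎ (y ≡ - r mod p)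
roots-±-mod-prime {p} {δ} {r} p-prime r-root y y-root =
  Sum.map (≡-mod ∘ Signed.∣ᵤ⇒∣) ∣+⇒≡-mod-neg
    (prime∣*⇒∣⊎∣ p-prime (y - r) (y + r) (roots⇒∣* {δ} {y = y} {r} y-root r-root))

root-unique-mod-prime : ∀ {p δ r} → Prime p → + p ∣ + 2 * r → norm δ r ≡ + 0 mod p →
  ∀ y → norm δ y ≡ + 0 mod p → y ≡ r mod p
root-unique-mod-prime p-prime p∣2r r-root y y-root =
  [ id , (λ y≡-r → ≡-mod-trans y≡-r (≡-mod-sym (∣2*⇒≡-mod-neg p∣2r))) ]′
    (roots-±-mod-prime p-prime r-root y y-root)

roots-±-mod-prime-power : ∀ {p δ r} k → Prime p → ¬ + p ∣ + 2 * r → norm δ r ≡ + 0 mod p ℕ.^ k →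
  ∀ y → norm δ y ≡ + 0 mod p ℕ.^ k → (y ≡ r mod p ℕ.^ k) ⊎ (y ≡ - r mod p ℕ.^ k)
roots-±-mod-prime-power {p} {δ} {r} k p-prime p∤2r r-root y y-root with p ℕ.∣? ∣ y - r ∣
... | no p∤y-r = inj₂ (∣+⇒≡-mod-neg (coprime∧∣*⇒∣ (y - r) (y + r)
        (coprime-^ (prime∤⇒coprime p-prime p∤y-r) k) (roots⇒∣* {δ} {y = y} {r} y-root r-root)))
... | yes p∣y-r = inj₁ (≡-mod (Signed.∣ᵤ⇒∣ (coprime∧∣*⇒∣ (y + r) (y - r)
        (coprime-^ (prime∤⇒coprime p-prime p∤y+r) k)
        (subst (+ (p ℕ.^ k) ∣_) (ℤ.*-comm (y - r) (y + r)) (roots⇒∣* {δ} {y = y} {r} y-root r-root)))))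
  where
  y≡r : y ≡ r mod p
  y≡r = ≡-mod (Signed.∣ᵤ⇒∣ p∣y-r)
  p∤y+r : ¬ + p ∣ y + r
  p∤y+r p∣y+r = p∤2r (≡-mod-neg⇒∣2* (≡-mod-trans (≡-mod-sym y≡r) (∣+⇒≡-mod-neg p∣y+r)))

prime∣2⇒≡2 : ∀ {p} → Prime p → p ∣ℕ 2 → p ≡ 2
prime∣2⇒≡2 p-prime p∣2 with prime⇒irreducible prime[2] p∣2
... | inj₁ refl = contradiction p-prime ¬prime[1]
... | inj₂ p≡2 = p≡2

unramified⇒∤2r : ∀ {p δ r} → Prime p → p ≢ 2 → ¬ + p ∣ δ → norm δ r ≡ + 0 mod p → ¬ + p ∣ + 2 * r
unramified⇒∤2r {p} {δ} {r} p-prime p≢2 p∤δ r-root p∣2r with prime∣*⇒∣⊎∣ p-prime (+ 2) r p∣2r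
... | inj₁ p∣2 = p≢2 (prime∣2⇒≡2 p-prime p∣2)
... | inj₂ p∣r = p∤δ (≡-mod-0⇒∣ (≡-mod-trans (≡-mod-sym (norm≡0⇒square≡ {δ} {p} {r} r-root)) r²≡0))
  where
  r≡0 : r ≡ + 0 mod p
  r≡0 = ∣⇒≡-mod-0 p∣r
  r²≡0 : r * r ≡ + 0 mod p
  r²≡0 = ≡-mod-* r≡0 r≡0

squareFree⇒no-root-mod-p² : ∀ {δ p} → SquareFree δ → Prime p → + p ∣ δ → ∀ y → ¬ norm δ y ≡ + 0 mod p ℕ.* p
squareFree⇒no-root-mod-p² {δ} {p} δ-sqf p-prime p∣δ y y-root = δ-sqf p p-prime (≡-mod-0⇒∣ δ≡0)
  where
  y²≡δ : y * y ≡ δ mod p ℕ.* p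
  y²≡δ = norm≡0⇒square≡ {δ} {p ℕ.* p} {y} y-root
  p∣y : + p ∣ y
  p∣y = [ id , id ]′ (prime∣*⇒∣⊎∣ p-prime y y
    (≡-mod-0⇒∣ (≡-mod-trans (≡-mod-∣ (ℕ.m∣m*n p) y²≡δ) (∣⇒≡-mod-0 p∣δ))))
  p²∣y² : + (p ℕ.* p) ∣ y * y
  p²∣y² = subst (p ℕ.* p ∣ℕ_) (sym (ℤ.abs-* y y)) (ℕ.*-pres-∣ p∣y p∣y)
  δ≡0 : δ ≡ + 0 mod p ℕ.* p
  δ≡0 = ≡-mod-trans (≡-mod-sym y²≡δ) (∣⇒≡-mod-0 p²∣y²)

odd⇒≡1-mod-2 : ∀ {x} → ¬ + 2 ∣ x → x ≡ + 1 mod 2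
odd⇒≡1-mod-2 {x} 2∤x with x %ℕ 2 | n%ℕd<d x 2 | %ℕ-≡-mod x 2
... | 0 | _ | 0≡x = contradiction (≡-mod-0⇒∣ (≡-mod-sym 0≡x)) 2∤x
... | 1 | _ | 1≡x = ≡-mod-sym 1≡x
... | suc (suc _) | s≤s (s≤s ()) | _

≡1-mod-2⇒square≡1-mod-4 : ∀ {y} → y ≡ + 1 mod 2 → y * y ≡ + 1 mod 4
≡1-mod-2⇒square≡1-mod-4 {y} (≡-mod (Signed.divides t y-1≡2t)) =
  ≡-mod (Signed.divides (t * t + t) (trans (cong (λ z → z * z - + 1) (y≡2t+1 y-1≡2t)) (identity t)))
  where
  y≡2t+1 : ∀ {d} → y - + 1 ≡ d → y ≡ d + + 1
  y≡2t+1 refl = shift y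
    where
    shift : ∀ y → y ≡ y - + 1 + + 1
    shift = solve-∀
  identity : ∀ t → (t * + 2 + + 1) * (t * + 2 + + 1) - + 1 ≡ (t * t + t) * + 4
  identity = solve-∀

no-root-mod-4 : ∀ {δ} → ¬ + 2 ∣ δ → ¬ + 4 ∣ δ - + 1 → ∀ y → ¬ norm δ y ≡ + 0 mod 4
no-root-mod-4 {δ} 2∤δ 4∤δ-1 y y-root = 4∤δ-1 (Signed.∣⇒∣ᵤ (_≡_mod_.∣-diff δ≡1))
  where
  1-root : norm δ (+ 1) ≡ + 0 mod 2
  1-root = square≡⇒norm≡0 {δ} {2} {+ 1} (≡-mod-sym (odd⇒≡1-mod-2 2∤δ))
  y≡1 : y ≡ + 1 mod 2
  y≡1 = root-unique-mod-prime prime[2] (ℕ.∣-refl {2}) 1-root y (≡-mod-∣ (ℕ.m∣m*n 2) y-root)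
  δ≡1 : δ ≡ + 1 mod 4
  δ≡1 = ≡-mod-trans (≡-mod-sym (norm≡0⇒square≡ {δ} {4} {y} y-root)) (≡1-mod-2⇒square≡1-mod-4 y≡1)

-- Newton's step r ↦ r - (r² - δ) (2r)⁻¹ with the inverse taken mod p.
hensel : ∀ {p δ r} k → Prime p → ¬ + p ∣ + 2 * r → norm δ r ≡ + 0 mod p ℕ.^ suc k →
  ∃ λ r′ → norm δ r′ ≡ + 0 mod p ℕ.^ suc (suc k)
hensel {p} {δ} {r} k p-prime p∤2r r-root =
  newton (≡-mod-0⇒quotient r-root) (inverse-mod (+ 2 * r) (prime∤⇒coprime p-prime p∤2r))
  where
  open ≡-Reasoning
  expand : ∀ r s w N → (r - s * w * N) * (r - s * w * N) - (r * r - s * N) ≡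
    s * N * (+ 1 - w * (+ 2 * r)) + s * s * w * w * N * N
  expand = solve-∀
  factor : ∀ s w e P Q → s * (P * Q) * - (e * P) + s * s * w * w * (P * Q) * (P * Q) ≡
    (s * s * w * w * Q - s * e) * (P * (P * Q))
  factor = solve-∀
  P Q N : ℤ
  P = + p
  Q = + (p ℕ.^ k)
  N = P * Q
  p^k+1≡N : + (p ℕ.^ suc k) ≡ N
  p^k+1≡N = ℤ.pos-* p (p ℕ.^ k)
  p^k+2≡PN : + (p ℕ.^ suc (suc k)) ≡ P * N
  p^k+2≡PN = trans (ℤ.pos-* p (p ℕ.^ suc k)) (cong (P *_) p^k+1≡N)
  newton : (∃ λ s → norm δ r ≡ s * + (p ℕ.^ suc k)) → (∃ λ w → w * (+ 2 * r) ≡ + 1 mod p) →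
    ∃ λ r′ → norm δ r′ ≡ + 0 mod p ℕ.^ suc (suc k)
  newton (s , r²-δ≡s[p^k+1]) (w , ≡-mod (Signed.divides e 2rw-1≡ep)) =
    r′ , quotient⇒≡-mod-0 (s * s * w * w * Q - s * e) (begin
      r′ * r′ - δ                                        ≡⟨ cong (λ d → r′ * r′ - d) δ≡r²-sN ⟩
      r′ * r′ - (r * r - s * N)                          ≡⟨ expand r s w N ⟩
      s * N * (+ 1 - w * (+ 2 * r)) + s * s * w * w * N * N
        ≡⟨ cong (λ t → s * N * t + s * s * w * w * N * N) 1-2rw≡-ep ⟩
      s * N * - (e * P) + s * s * w * w * N * N          ≡⟨ factor s w e P Q ⟩
      (s * s * w * w * Q - s * e) * (P * N)              ≡⟨ cong (λ t → (s * s * w * w * Q - s * e) * t) (sym p^k+2≡PN) ⟩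
      (s * s * w * w * Q - s * e) * + (p ℕ.^ suc (suc k)) ∎)
    where
    r′ : ℤ
    r′ = r - s * w * N
    δ≡r²-sN : δ ≡ r * r - s * N
    δ≡r²-sN = solve-for-δ (trans r²-δ≡s[p^k+1] (cong (s *_) p^k+1≡N))
      where
      solve-for-δ : ∀ {a} → r * r - δ ≡ a → δ ≡ r * r - a
      solve-for-δ refl = identity r δ
        where
        identity : ∀ r δ → δ ≡ r * r - (r * r - δ)
        identity = solve-∀
    1-2rw≡-ep : + 1 - w * (+ 2 * r) ≡ - (e * P)
    1-2rw≡-ep = trans (identity w r) (cong -_ 2rw-1≡ep)
      where
      identity : ∀ w r → + 1 - w * (+ 2 * r) ≡ - (w * (+ 2 * r) - + 1)
      identity = solve-∀

lift-root : ∀ {p δ r} → Prime p → p ≢ 2 → ¬ + p ∣ δ → norm δ r ≡ + 0 mod p →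
  ∀ k → ∃ λ r′ → norm δ r′ ≡ + 0 mod p ℕ.^ suc k
lift-root {p} {δ} {r} p-prime p≢2 p∤δ r-root zero = r , subst (norm δ r ≡ + 0 mod_) (sym (ℕ.*-identityʳ p)) r-root
lift-root {p} {δ} {r} p-prime p≢2 p∤δ r-root (suc k) with lift-root {p} {δ} {r} p-prime p≢2 p∤δ r-root k
... | r′ , r′-root = hensel {p} {δ} {r′} k p-prime
  (unramified⇒∤2r {p} {δ} {r′} p-prime p≢2 p∤δ (≡-mod-∣ (ℕ.m∣m*n (p ℕ.^ k)) r′-root)) r′-root

-- The arithmetic functions μ² and χ

primeFactors : (n : ℕ) → .{{NonZero n}} → List ℕ
primeFactors n = factors (factorise n)

primeFactors-* : ∀ a b .{{_ : NonZero a}} .{{_ : NonZero b}} →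
  primeFactors (a ℕ.* b) {{ℕ.m*n≢0 a b}} ↭ primeFactors a ++ primeFactors b
primeFactors-* a b = factorisationUnique (factorise (a ℕ.* b) {{ℕ.m*n≢0 a b}}) (record
  { factors = primeFactors a ++ primeFactors b
  ; isFactorisation = trans (cong₂ ℕ._*_ (isFactorisation (factorise a)) (isFactorisation (factorise b)))
                            (sym (product-++ (primeFactors a) (primeFactors b)))
  ; factorsPrime = All.++⁺ (factorsPrime (factorise a)) (factorsPrime (factorise b))
  })
  where open PrimeFactorisation

primeFactors-prime : ∀ {p} (p-prime : Prime p) → primeFactors p {{prime⇒nonZero p-prime}} ↭ p ∷ []
primeFactors-prime {p} p-prime = factorisationUnique (factorise p {{prime⇒nonZero p-prime}}) (primeFactorisation[p] p-prime)

primeFactors-prime* : ∀ {p} (p-prime : Prime p) n .{{_ : NonZero n}} →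
  primeFactors (p ℕ.* n) {{ℕ.m*n≢0 p n {{prime⇒nonZero p-prime}}}} ↭ p ∷ primeFactors n
primeFactors-prime* p-prime n =
  ↭-trans (primeFactors-* _ n {{prime⇒nonZero p-prime}}) (++⁺ʳ (primeFactors n) (primeFactors-prime p-prime))

∈-primeFactors⇒∣ : ∀ {n} .{{_ : NonZero n}} {q} → q ∈ primeFactors n → q ∣ℕ n
∈-primeFactors⇒∣ {n} {q} q∈ =
  subst (q ∣ℕ_) (sym (PrimeFactorisation.isFactorisation (factorise n))) (∈⇒∣product q∈)

μ² : ℕ → ℤ
μ² zero = + 0
μ² n@(suc _) = möbius n * möbius n

signs²≡1 : ∀ (xs : List ℕ) → foldr (λ _ r → - r) (+ 1) xs * foldr (λ _ r → - r) (+ 1) xs ≡ + 1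
signs²≡1 [] = refl
signs²≡1 (_ ∷ xs) = trans (neg*neg (foldr (λ _ r → - r) (+ 1) xs)) (signs²≡1 xs)
  where
  neg*neg : ∀ r → - r * - r ≡ r * r
  neg*neg = solve-∀

μ²-squarefree : ∀ n .{{_ : NonZero n}} → Unique (primeFactors n) → μ² n ≡ + 1
μ²-squarefree n@(suc _) distinct with allPairs? (λ x y → ¬? (x ℕ.≟ y)) (primeFactors n)
... | yes _ = signs²≡1 (primeFactors n)
... | no repeated = contradiction distinct repeated

μ²-not-squarefree : ∀ n .{{_ : NonZero n}} → ¬ Unique (primeFactors n) → μ² n ≡ + 0
μ²-not-squarefree n@(suc _) repeated with allPairs? (λ x y → ¬? (x ℕ.≟ y)) (primeFactors n)
... | yes distinct = contradiction distinct repeated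
... | no _ = refl

μ²-prime* : ∀ {p} → Prime p → ∀ l → ¬ p ∣ℕ l → μ² (p ℕ.* l) ≡ μ² l
μ²-prime* {p} p-prime zero p∤l = contradiction (p ℕ.∣0) p∤l
μ²-prime* {p} p-prime l@(suc _) p∤l = by-cases (unique? (primeFactors l))
  where
  pl≢0 : NonZero (p ℕ.* l)
  pl≢0 = ℕ.m*n≢0 p l {{prime⇒nonZero p-prime}}
  p∷l-factors : primeFactors (p ℕ.* l) {{pl≢0}} ↭ p ∷ primeFactors l
  p∷l-factors = primeFactors-prime* p-prime l
  by-cases : Dec (Unique (primeFactors l)) → μ² (p ℕ.* l) ≡ μ² l
  by-cases (yes distinct) = trans
    (μ²-squarefree (p ℕ.* l) {{pl≢0}} (Unique-resp-↭ (setoid ℕ) (↭⇒↭ₛ (↭-sym p∷l-factors)) p∷distinct))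
    (sym (μ²-squarefree l distinct))
    where
    p∷distinct : Unique (p ∷ primeFactors l)
    p∷distinct = All.tabulate (λ q∈ p≡q → p∤l (subst (_∣ℕ l) (sym p≡q) (∈-primeFactors⇒∣ q∈))) ∷ distinct
  by-cases (no repeated) = trans
    (μ²-not-squarefree (p ℕ.* l) {{pl≢0}} (repeated ∘ AllPairs.tail ∘ Unique-resp-↭ (setoid ℕ) (↭⇒↭ₛ p∷l-factors)))
    (sym (μ²-not-squarefree l repeated))

μ²-prime² : ∀ {p} → Prime p → ∀ l → μ² (p ℕ.* (p ℕ.* l)) ≡ + 0
μ²-prime² {p} p-prime zero = cong μ² (trans (cong (p ℕ.*_) (ℕ.*-zeroʳ p)) (ℕ.*-zeroʳ p))
μ²-prime² {p} p-prime l@(suc _) =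
  μ²-not-squarefree (p ℕ.* (p ℕ.* l)) {{ppl≢0}} (p-repeated ∘ Unique-resp-↭ (setoid ℕ) (↭⇒↭ₛ p∷p∷l-factors))
  where
  instance
    p≢0 : NonZero p
    p≢0 = prime⇒nonZero p-prime
  pl≢0 : NonZero (p ℕ.* l)
  pl≢0 = ℕ.m*n≢0 p l
  ppl≢0 : NonZero (p ℕ.* (p ℕ.* l))
  ppl≢0 = ℕ.m*n≢0 p (p ℕ.* l) {{p≢0}} {{pl≢0}}
  p∷p∷l-factors : primeFactors (p ℕ.* (p ℕ.* l)) {{ppl≢0}} ↭ p ∷ p ∷ primeFactors l
  p∷p∷l-factors = ↭-trans (primeFactors-prime* p-prime (p ℕ.* l) {{pl≢0}}) (prep p (primeFactors-prime* p-prime l))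
  p-repeated : ¬ Unique (p ∷ p ∷ primeFactors l)
  p-repeated ((p≢p ∷ _) ∷ _) = p≢p refl

prodℤ-++ : ∀ xs ys → prodℤ (xs ++ ys) ≡ prodℤ xs * prodℤ ys
prodℤ-++ [] ys = sym (ℤ.*-identityˡ _)
prodℤ-++ (x ∷ xs) ys = trans (cong (x *_) (prodℤ-++ xs ys)) (sym (ℤ.*-assoc x _ _))

prodℤ-↭ : ∀ {xs ys} → xs ↭ ys → prodℤ xs ≡ prodℤ ys
prodℤ-↭ p = foldr-commMonoid (setoid ℤ) ℤ.*-1-isCommutativeMonoid (↭⇒↭ₛ p)

jacobi-* : ∀ δ a b .{{_ : NonZero a}} .{{_ : NonZero b}} →
  jacobi δ (a ℕ.* b) {{ℕ.m*n≢0 a b}} ≡ jacobi δ a * jacobi δ b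
jacobi-* δ a b = begin
  prodℤ (map (legendre δ) (primeFactors (a ℕ.* b) {{ℕ.m*n≢0 a b}}))
    ≡⟨ prodℤ-↭ (map⁺ (legendre δ) (primeFactors-* a b)) ⟩
  prodℤ (map (legendre δ) (primeFactors a ++ primeFactors b))
    ≡⟨ cong prodℤ (map-++ (legendre δ) (primeFactors a) (primeFactors b)) ⟩
  prodℤ (map (legendre δ) (primeFactors a) ++ map (legendre δ) (primeFactors b))
    ≡⟨ prodℤ-++ (map (legendre δ) (primeFactors a)) (map (legendre δ) (primeFactors b)) ⟩
  jacobi δ a * jacobi δ b                                              ∎
  where open ≡-Reasoning

jacobi-prime : ∀ δ {p} (p-prime : Prime p) → jacobi δ p {{prime⇒nonZero p-prime}} ≡ legendre δ p
jacobi-prime δ {p} p-prime =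
  trans (prodℤ-↭ (map⁺ (legendre δ) (primeFactors-prime p-prime))) (ℤ.*-identityʳ (legendre δ p))

χ-coprime : ∀ δ n .{{_ : NonZero n}} → Coprime n (2 ℕ.* ∣ δ ∣) → χ δ n ≡ jacobi δ n
χ-coprime δ n n⊥2δ with gcd n (2 ℕ.* ∣ δ ∣) ℕ.≟ 1
... | yes _ = refl
... | no gcd≢1 = contradiction (Coprime.coprime⇒gcd≡1 n⊥2δ) gcd≢1

χ-not-coprime : ∀ δ n .{{_ : NonZero n}} → ¬ Coprime n (2 ℕ.* ∣ δ ∣) → χ δ n ≡ + 0
χ-not-coprime δ n n/⊥2δ with gcd n (2 ℕ.* ∣ δ ∣) ℕ.≟ 1
... | yes gcd≡1 = ⊥-elim (n/⊥2δ (Coprime.gcd≡1⇒coprime gcd≡1))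
... | no _ = refl

χ₀ : ℤ → ℕ → ℤ
χ₀ δ zero = + 0
χ₀ δ n@(suc _) = χ δ n

χ₀≡χ : ∀ δ n .{{_ : NonZero n}} → χ₀ δ n ≡ χ δ n
χ₀≡χ δ (suc _) = refl

χ₀-1 : ∀ δ → χ₀ δ 1 ≡ + 1
χ₀-1 δ = χ-coprime δ 1 (Coprime.1-coprimeTo _)

χ₀-* : ∀ δ a b → χ₀ δ (a ℕ.* b) ≡ χ₀ δ a * χ₀ δ b
χ₀-* δ zero b = refl
χ₀-* δ a@(suc _) zero = trans (cong (χ₀ δ) (ℕ.*-zeroʳ a)) (sym (ℤ.*-zeroʳ (χ₀ δ a)))
χ₀-* δ a@(suc _) b@(suc _) = by-cases (Coprime.coprime? a (2 ℕ.* ∣ δ ∣)) (Coprime.coprime? b (2 ℕ.* ∣ δ ∣))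
  where
  by-cases : Dec (Coprime a (2 ℕ.* ∣ δ ∣)) → Dec (Coprime b (2 ℕ.* ∣ δ ∣)) → χ δ (a ℕ.* b) ≡ χ δ a * χ δ b
  by-cases (yes a⊥2δ) (yes b⊥2δ) = begin
    χ δ (a ℕ.* b)            ≡⟨ χ-coprime δ (a ℕ.* b) (coprime-* a⊥2δ b⊥2δ) ⟩
    jacobi δ (a ℕ.* b)       ≡⟨ jacobi-* δ a b ⟩
    jacobi δ a * jacobi δ b  ≡⟨ cong₂ _*_ (χ-coprime δ a a⊥2δ) (χ-coprime δ b b⊥2δ) ⟨
    χ δ a * χ δ b            ∎
    where open ≡-Reasoning
  by-cases (no a/⊥2δ) _ = trans (χ-not-coprime δ (a ℕ.* b) (λ ab⊥2δ → a/⊥2δ (coprime-*⁻ˡ {b = b} ab⊥2δ)))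
    (sym (trans (cong (_* χ δ b) (χ-not-coprime δ a a/⊥2δ)) (ℤ.*-zeroˡ (χ δ b))))
  by-cases _ (no b/⊥2δ) = trans (χ-not-coprime δ (a ℕ.* b) (λ ab⊥2δ → b/⊥2δ (coprime-*⁻ʳ {a} ab⊥2δ)))
    (sym (trans (cong (χ δ a *_) (χ-not-coprime δ b b/⊥2δ)) (ℤ.*-zeroʳ (χ δ a))))

χ₀-ramified : ∀ δ {p} → Prime p → p ∣ℕ 2 ℕ.* ∣ δ ∣ → ∀ j → χ₀ δ (p ℕ.^ suc j) ≡ + 0
χ₀-ramified δ {p} p-prime p∣2δ j = trans (χ₀≡χ δ (p ℕ.^ suc j)) (χ-not-coprime δ (p ℕ.^ suc j)
  (λ p^j+1⊥2δ → ¬prime[1] (subst Prime (p^j+1⊥2δ (ℕ.m∣m*n (p ℕ.^ j) , p∣2δ)) p-prime)))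
  where
  instance
    p^j+1≢0 : NonZero (p ℕ.^ suc j)
    p^j+1≢0 = ℕ.m^n≢0 p (suc j) {{prime⇒nonZero p-prime}}

χ₀-prime-power : ∀ δ {p} → Prime p → p ≢ 2 → ¬ + p ∣ δ → ∀ j → χ₀ δ (p ℕ.^ j) ≡ legendre δ p ℤ.^ j
χ₀-prime-power δ {p} p-prime p≢2 p∤δ zero = χ₀-1 δ
χ₀-prime-power δ {p} p-prime p≢2 p∤δ (suc j) = begin
  χ₀ δ (p ℕ.* p ℕ.^ j)                  ≡⟨ χ₀-* δ p (p ℕ.^ j) ⟩
  χ₀ δ p * χ₀ δ (p ℕ.^ j)               ≡⟨ cong₂ _*_ χ₀[p]≡legendre (χ₀-prime-power δ p-prime p≢2 p∤δ j) ⟩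
  legendre δ p * legendre δ p ℤ.^ j     ∎
  where
  open ≡-Reasoning
  instance
    p≢0 : NonZero p
    p≢0 = prime⇒nonZero p-prime
  p⊥2δ : Coprime p (2 ℕ.* ∣ δ ∣)
  p⊥2δ = Coprime.sym (coprime-* (Coprime.sym (prime∤⇒coprime p-prime (p≢2 ∘ prime∣2⇒≡2 p-prime)))
                                (Coprime.sym (prime∤⇒coprime p-prime p∤δ)))
  χ₀[p]≡legendre : χ₀ δ p ≡ legendre δ p
  χ₀[p]≡legendre = trans (χ₀≡χ δ p) (trans (χ-coprime δ p p⊥2δ) (jacobi-prime δ p-prime))

χ₀-local-factor : ∀ δ {p} → Prime p → p ≢ 2 → ¬ + p ∣ δ →
  ∀ k → χ₀ δ (p ℕ.^ suc k) + χ₀ δ (p ℕ.^ k) ≡ legendre δ p ℤ.^ suc k + legendre δ p ℤ.^ k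
χ₀-local-factor δ p-prime p≢2 p∤δ k =
  cong₂ _+_ (χ₀-prime-power δ p-prime p≢2 p∤δ (suc k)) (χ₀-prime-power δ p-prime p≢2 p∤δ k)

legendre-cases : ∀ {δ p} .{{_ : NonZero p}} → ¬ + p ∣ δ →
  (legendre δ p ≡ + 1 × ∃ λ r → norm δ r ≡ + 0 mod p) ⊎ (legendre δ p ≡ - + 1 × ∀ y → ¬ norm δ y ≡ + 0 mod p)
legendre-cases {δ} {p} p∤δ with (+ p) ∣ℤ? δ
... | yes p∣δ = contradiction p∣δ p∤δ
... | no _ with any? (λ x → (+ p) ∣ℤ? norm δ (+ x)) (upTo p)
...   | yes root = inj₁ (refl , Data.Product.map +_ ∣⇒≡-mod-0 (Any.satisfied root))
...   | no no-root = inj₂ (refl , λ y y-root → no-root (lose (∈-upTo⁺ (n%ℕd<d y p))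
          (≡-mod-0⇒∣ (root-≡-mod (norm-cong δ) (%ℕ-≡-mod y p) y-root))))

-- Divisor sums

divisors : ℕ → List ℕ
divisors n = filter (ℕ._∣? n) (map suc (upTo n))

divisors-unique : ∀ n → Unique (divisors n)
divisors-unique n = Unique.filter⁺ (ℕ._∣? n) (Unique.map⁺ ℕ.suc-injective (Unique.upTo⁺ n))

∈-divisors⁺ : ∀ {n l} .{{_ : NonZero n}} → l ∣ℕ n → l ∈ divisors n
∈-divisors⁺ {n} {zero} 0∣n = contradiction (ℕ.0∣⇒≡0 0∣n) (ℕ.≢-nonZero⁻¹ n)
∈-divisors⁺ {n} {suc l} l∣n = ∈-filter⁺ (ℕ._∣? n) (∈-map⁺ suc (∈-upTo⁺ (ℕ.∣⇒≤ l∣n))) l∣n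

∈-divisors⁻ : ∀ {n l} → l ∈ divisors n → l ∣ℕ n
∈-divisors⁻ {n} l∈ = proj₂ (∈-filter⁻ (ℕ._∣? n) {xs = map suc (upTo n)} l∈)

divisorSum : ℕ → (ℕ → ℤ) → ℤ
divisorSum n f = sumℤ (map f (divisors n))

divisorSum-cong : ∀ n {f g : ℕ → ℤ} → (∀ l → l ∣ℕ n → f l ≡ g l) → divisorSum n f ≡ divisorSum n g
divisorSum-cong n f≗g = sumℤ-map-cong (divisors n) (λ {l} l∈ → f≗g l (∈-divisors⁻ l∈))

divisorSum-*ˡ : ∀ n c (f : ℕ → ℤ) → divisorSum n (λ l → c * f l) ≡ c * divisorSum n f
divisorSum-*ˡ n c f = sumℤ-map-*ˡ c f (divisors n)

module _ {p m : ℕ} (p-prime : Prime p) (p∤m : ¬ p ∣ℕ m) where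

  private
    instance
      p≢0 : NonZero p
      p≢0 = prime⇒nonZero p-prime
      m≢0 : NonZero m
      m≢0 = ∤⇒nonZero p∤m

    p^k*m≢0 : ∀ k → NonZero (p ℕ.^ k ℕ.* m)
    p^k*m≢0 k = ℕ.m*n≢0 (p ℕ.^ k) m {{ℕ.m^n≢0 p k}}

  -- A divisor of p^(k+1)·m either is prime to p, hence divides m, or is p times a divisor of p^k·m.
  divisors-prime* : ∀ k → divisors (p ℕ.* (p ℕ.^ k ℕ.* m)) ↭ divisors m ++ map (p ℕ.*_) (divisors (p ℕ.^ k ℕ.* m))
  divisors-prime* k = ∼bag⇒↭ (unique∧set⇒bag (divisors-unique (p ℕ.* n)) split-unique (mk⇔ to from))
    where
    n : ℕ
    n = p ℕ.^ k ℕ.* m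
    instance
      n≢0 : NonZero n
      n≢0 = p^k*m≢0 k
      pn≢0 : NonZero (p ℕ.* n)
      pn≢0 = ℕ.m*n≢0 p n
    split-unique : Unique (divisors m ++ map (p ℕ.*_) (divisors n))
    split-unique = Unique.++⁺ (divisors-unique m)
      (Unique.map⁺ (ℕ.*-cancelˡ-≡ _ _ p) (divisors-unique n))
      (λ (l∈m , l∈pn) → case ∈-map⁻ (p ℕ.*_) l∈pn of λ where
        (q , _ , refl) → p∤m (ℕ.∣-trans (ℕ.m∣m*n q) (∈-divisors⁻ l∈m)))
    p·n≡p^k+1·m : p ℕ.* n ≡ p ℕ.^ suc k ℕ.* m
    p·n≡p^k+1·m = sym (ℕ.*-assoc p (p ℕ.^ k) m)
    to : ∀ {l} → l ∈ divisors (p ℕ.* n) → l ∈ divisors m ++ map (p ℕ.*_) (divisors n)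
    to {l} l∈ with p ℕ.∣? l
    ... | yes (divides q refl) = ∈-++⁺ʳ (divisors m) (subst (_∈ map (p ℕ.*_) (divisors n)) (ℕ.*-comm p q)
          (∈-map⁺ (p ℕ.*_) (∈-divisors⁺ (ℕ.*-cancelˡ-∣ p
            (subst (_∣ℕ p ℕ.* n) (ℕ.*-comm q p) (∈-divisors⁻ l∈))))))
    ... | no p∤l = ∈-++⁺ˡ (∈-divisors⁺
          (Coprime.coprime-divisor l⊥p^k+1 (subst (l ∣ℕ_) p·n≡p^k+1·m (∈-divisors⁻ l∈))))
      where
      l⊥p^k+1 : Coprime l (p ℕ.^ suc k)
      l⊥p^k+1 = Coprime.sym (coprime-^ (prime∤⇒coprime p-prime p∤l) (suc k))
    from : ∀ {l} → l ∈ divisors m ++ map (p ℕ.*_) (divisors n) → l ∈ divisors (p ℕ.* n)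
    from {l} l∈ with ∈-++⁻ (divisors m) l∈
    ... | inj₁ l∈m =
      ∈-divisors⁺ (subst (l ∣ℕ_) (sym p·n≡p^k+1·m) (ℕ.∣n⇒∣m*n (p ℕ.^ suc k) (∈-divisors⁻ l∈m)))
    ... | inj₂ l∈pn with ∈-map⁻ (p ℕ.*_) l∈pn
    ...   | q , q∈n , refl = ∈-divisors⁺ (ℕ.*-monoʳ-∣ p (∈-divisors⁻ q∈n))

  divisorSum-prime* : ∀ k f → divisorSum (p ℕ.* (p ℕ.^ k ℕ.* m)) f ≡
    divisorSum m f + divisorSum (p ℕ.^ k ℕ.* m) (λ l → f (p ℕ.* l))
  divisorSum-prime* k f = begin
    sumℤ (map f (divisors (p ℕ.* n)))                               ≡⟨ sumℤ-↭ (map⁺ f (divisors-prime* k)) ⟩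
    sumℤ (map f (divisors m ++ map (p ℕ.*_) (divisors n)))          ≡⟨ cong sumℤ (map-++ f (divisors m) _) ⟩
    sumℤ (map f (divisors m) ++ map f (map (p ℕ.*_) (divisors n)))  ≡⟨ sumℤ-++ (map f (divisors m)) _ ⟩
    divisorSum m f + sumℤ (map f (map (p ℕ.*_) (divisors n)))
      ≡⟨ cong (λ t → divisorSum m f + sumℤ t) (map-∘ (divisors n)) ⟨
    divisorSum m f + divisorSum n (λ l → f (p ℕ.* l))               ∎
    where
    open ≡-Reasoning
    n : ℕ
    n = p ℕ.^ k ℕ.* m

  divisorSum-prime-power : ∀ f → (∀ l → p ∣ℕ l → f l ≡ + 0) →
    ∀ k → divisorSum (p ℕ.^ k ℕ.* m) f ≡ divisorSum m f
  divisorSum-prime-power f vanish zero = cong (λ n → divisorSum n f) (ℕ.*-identityˡ m)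
  divisorSum-prime-power f vanish (suc k) = begin
    divisorSum (p ℕ.^ suc k ℕ.* m) f
      ≡⟨ cong (λ n → divisorSum n f) (ℕ.*-assoc p (p ℕ.^ k) m) ⟩
    divisorSum (p ℕ.* (p ℕ.^ k ℕ.* m)) f
      ≡⟨ divisorSum-prime* k f ⟩
    divisorSum m f + divisorSum (p ℕ.^ k ℕ.* m) (λ l → f (p ℕ.* l))
      ≡⟨ cong (λ t → divisorSum m f + t) multiples-vanish ⟩
    divisorSum m f + + 0                                              ≡⟨ ℤ.+-identityʳ _ ⟩
    divisorSum m f                                                    ∎
    where
    open ≡-Reasoning
    multiples-vanish : divisorSum (p ℕ.^ k ℕ.* m) (λ l → f (p ℕ.* l)) ≡ + 0
    multiples-vanish = sumℤ-map-zero _ (divisors (p ℕ.^ k ℕ.* m)) (λ {l} _ → vanish (p ℕ.* l) (ℕ.m∣m*n l))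

-- Multiplicative functions

PrimePowerMultiplicative : (ℕ → ℤ) → Set
PrimePowerMultiplicative f =
  ∀ {p m} → Prime p → ¬ p ∣ℕ m → ∀ k → f (p ℕ.^ suc k ℕ.* m) ≡ f (p ℕ.^ suc k) * f m

prime-divisor : ∀ n .{{_ : NonZero n}} → n ≢ 1 → ∃ λ p → Prime p × p ∣ℕ n
prime-divisor n n≢1 with factorise n
... | record { factors = [] ; isFactorisation = n≡1 } = contradiction n≡1 n≢1
... | record { factors = p ∷ ps ; isFactorisation = n≡p*Πps ; factorsPrime = p-prime ∷ _ } =
  p , p-prime , divides (product ps) (trans n≡p*Πps (ℕ.*-comm p (product ps)))

prime-power-split : ∀ {p} → Prime p → ∀ n → NonZero n → ∃₂ λ k m → n ≡ p ℕ.^ k ℕ.* m × ¬ p ∣ℕ m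
prime-power-split {p} p-prime = <-rec _ split
  where
  split : ∀ n → (∀ {q} → q < n → NonZero q → ∃₂ λ k m → q ≡ p ℕ.^ k ℕ.* m × ¬ p ∣ℕ m) →
    NonZero n → ∃₂ λ k m → n ≡ p ℕ.^ k ℕ.* m × ¬ p ∣ℕ m
  split n rec n≢0 with p ℕ.∣? n
  ... | no p∤n = 0 , n , sym (ℕ.*-identityˡ n) , p∤n
  ... | yes (divides q n≡qp) with rec q<n q≢0
    where
    q≢0 : NonZero q
    q≢0 = ℕ.≢-nonZero (λ { refl → ℕ.≢-nonZero⁻¹ n {{n≢0}} n≡qp })
    q<n : q < n
    q<n = subst (q <_) (sym n≡qp) (ℕ.m<m*n q p {{q≢0}} (ℕ.nonTrivial⇒n>1 p {{prime⇒nonTrivial p-prime}}))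
  ... | k , m , q≡p^k*m , p∤m = suc k , m , n≡p^k+1*m , p∤m
    where
    n≡p^k+1*m : n ≡ p ℕ.^ suc k ℕ.* m
    n≡p^k+1*m = begin
      n                        ≡⟨ n≡qp ⟩
      q ℕ.* p                  ≡⟨ cong (ℕ._* p) q≡p^k*m ⟩
      p ℕ.^ k ℕ.* m ℕ.* p      ≡⟨ ℕ.*-comm (p ℕ.^ k ℕ.* m) p ⟩
      p ℕ.* (p ℕ.^ k ℕ.* m)    ≡⟨ ℕ.*-assoc p (p ℕ.^ k) m ⟨
      p ℕ.^ suc k ℕ.* m        ∎
      where open ≡-Reasoning

primePower-determined : ∀ {f g} → PrimePowerMultiplicative f → PrimePowerMultiplicative g → f 1 ≡ g 1 →
  (∀ {p} → Prime p → ∀ k → f (p ℕ.^ suc k) ≡ g (p ℕ.^ suc k)) → ∀ n .{{_ : NonZero n}} → f n ≡ g n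
primePower-determined {f} {g} f-mult g-mult f1≡g1 agree n = <-rec _ step n (ℕ.≢-nonZero (ℕ.≢-nonZero⁻¹ n))
  where
  step : ∀ n → (∀ {m} → m < n → NonZero m → f m ≡ g m) → NonZero n → f n ≡ g n
  step 1 _ _ = f1≡g1
  step n@(suc (suc _)) rec n≢0 with prime-divisor n (λ ())
  ... | p , p-prime , p∣n with prime-power-split p-prime n n≢0
  ...   | zero , m , n≡m , p∤m = contradiction (subst (p ∣ℕ_) (trans n≡m (ℕ.*-identityˡ m)) p∣n) p∤m
  ...   | suc k , m , n≡p^k+1*m , p∤m = begin
    f n                              ≡⟨ cong f n≡p^k+1*m ⟩
    f (p ℕ.^ suc k ℕ.* m)            ≡⟨ f-mult p-prime p∤m k ⟩
    f (p ℕ.^ suc k) * f m            ≡⟨ cong₂ _*_ (agree p-prime k) (rec m<n m≢0) ⟩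
    g (p ℕ.^ suc k) * g m            ≡⟨ g-mult p-prime p∤m k ⟨
    g (p ℕ.^ suc k ℕ.* m)            ≡⟨ cong g n≡p^k+1*m ⟨
    g n                              ∎
    where
    open ≡-Reasoning
    m≢0 : NonZero m
    m≢0 = ∤⇒nonZero p∤m
    m<n : m < n
    m<n = subst (m <_) (trans (ℕ.*-comm m (p ℕ.^ suc k)) (sym n≡p^k+1*m))
      (ℕ.m<m*n m (p ℕ.^ suc k) {{m≢0}} (ℕ.<-≤-trans (ℕ.nonTrivial⇒n>1 p {{prime⇒nonTrivial p-prime}})
        (ℕ.m≤m*n p (p ℕ.^ k) {{ℕ.m^n≢0 p k {{prime⇒nonZero p-prime}}}})))

-- n ÷ 0 = 0 is a junk value, so that divisor sums need no NonZero instances.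
infixl 7 _÷_
_÷_ : ℕ → ℕ → ℕ
n ÷ zero = 0
n ÷ l@(suc _) = n / l

÷≡/ : ∀ n l .{{_ : NonZero l}} → n ÷ l ≡ n / l
÷≡/ n (suc _) = refl

*-÷-assoc : ∀ a {n l} → l ∣ℕ n → .{{NonZero n}} → a ℕ.* n ÷ l ≡ a ℕ.* (n ÷ l)
*-÷-assoc a {n} {zero} 0∣n = contradiction (ℕ.0∣⇒≡0 0∣n) (ℕ.≢-nonZero⁻¹ n)
*-÷-assoc a {n} {l@(suc _)} l∣n = *-/-assoc a l∣n

*-÷-cancelˡ : ∀ a n l .{{_ : NonZero a}} .{{l≢0 : NonZero l}} → a ℕ.* n ÷ (a ℕ.* l) ≡ n ÷ l
*-÷-cancelˡ a n l {{l≢0 = l≢0}} =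
  trans (÷≡/ (a ℕ.* n) (a ℕ.* l) {{ℕ.m*n≢0 a l}})
        (trans (m*n/m*o≡n/o a n l {{l≢0}} {{ℕ.m*n≢0 a l}}) (sym (÷≡/ n l)))

CompletelyMultiplicative : (ℕ → ℤ) → Set
CompletelyMultiplicative h = ∀ a b → h (a ℕ.* b) ≡ h a * h b

μ²⋆ : (ℕ → ℤ) → ℕ → ℤ
μ²⋆ h n = divisorSum n (λ l → μ² l * h (n ÷ l))

μ²⋆-prime-power : ∀ {h} → CompletelyMultiplicative h → ∀ {p m} → Prime p → ¬ p ∣ℕ m → ∀ k →
  μ²⋆ h (p ℕ.^ suc k ℕ.* m) ≡ (h (p ℕ.^ suc k) + h (p ℕ.^ k)) * μ²⋆ h m
μ²⋆-prime-power {h} h-mult {p} {m} p-prime p∤m k = begin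
  μ²⋆ h (p ℕ.^ suc k ℕ.* m)
    ≡⟨ cong (μ²⋆ h) (ℕ.*-assoc p (p ℕ.^ k) m) ⟩
  divisorSum (p ℕ.* n) (λ l → μ² l * h (p ℕ.* n ÷ l))
    ≡⟨ divisorSum-prime* p-prime p∤m k _ ⟩
  divisorSum m (λ l → μ² l * h (p ℕ.* n ÷ l)) + divisorSum n (λ l → μ² (p ℕ.* l) * h (p ℕ.* n ÷ (p ℕ.* l)))
    ≡⟨ cong₂ _+_ coprime-part multiple-part ⟩
  h (p ℕ.^ suc k) * μ²⋆ h m + h (p ℕ.^ k) * μ²⋆ h m
    ≡⟨ ℤ.*-distribʳ-+ (μ²⋆ h m) (h (p ℕ.^ suc k)) (h (p ℕ.^ k)) ⟨
  (h (p ℕ.^ suc k) + h (p ℕ.^ k)) * μ²⋆ h m ∎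
  where
  open ≡-Reasoning
  instance
    p≢0 : NonZero p
    p≢0 = prime⇒nonZero p-prime
    m≢0 : NonZero m
    m≢0 = ∤⇒nonZero p∤m
  n : ℕ
  n = p ℕ.^ k ℕ.* m
  swap-factor : ∀ a b c → a * (b * c) ≡ b * (a * c)
  swap-factor = solve-∀
  pull-out : ∀ j {f : ℕ → ℕ} → (∀ l → l ∣ℕ m → f l ≡ p ℕ.^ j ℕ.* (m ÷ l)) →
    divisorSum m (λ l → μ² l * h (f l)) ≡ h (p ℕ.^ j) * μ²⋆ h m
  pull-out j f≡ = trans
    (divisorSum-cong m (λ l l∣m → trans (cong (λ t → μ² l * h t) (f≡ l l∣m))
      (trans (cong (μ² l *_) (h-mult (p ℕ.^ j) (m ÷ l))) (swap-factor (μ² l) (h (p ℕ.^ j)) (h (m ÷ l))))))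
    (divisorSum-*ˡ m (h (p ℕ.^ j)) (λ l → μ² l * h (m ÷ l)))
  coprime-part : divisorSum m (λ l → μ² l * h (p ℕ.* n ÷ l)) ≡ h (p ℕ.^ suc k) * μ²⋆ h m
  coprime-part = pull-out (suc k) λ l l∣m →
    trans (cong (_÷ l) (sym (ℕ.*-assoc p (p ℕ.^ k) m))) (*-÷-assoc (p ℕ.^ suc k) l∣m)
  multiple-part : divisorSum n (λ l → μ² (p ℕ.* l) * h (p ℕ.* n ÷ (p ℕ.* l))) ≡ h (p ℕ.^ k) * μ²⋆ h m
  multiple-part = begin
    divisorSum n (λ l → μ² (p ℕ.* l) * h (p ℕ.* n ÷ (p ℕ.* l)))
      ≡⟨ divisorSum-prime-power p-prime p∤m _ p∣l⇒0 k ⟩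
    divisorSum m (λ l → μ² (p ℕ.* l) * h (p ℕ.* n ÷ (p ℕ.* l)))
      ≡⟨ divisorSum-cong m (λ l l∣m → cong (_* h (p ℕ.* n ÷ (p ℕ.* l))) (μ²-prime* p-prime l (p∤m ∘ flip ℕ.∣-trans l∣m))) ⟩
    divisorSum m (λ l → μ² l * h (p ℕ.* n ÷ (p ℕ.* l)))
      ≡⟨ pull-out k (λ l l∣m → trans (*-÷-cancelˡ p n l {{p≢0}} {{divisor≢0 l∣m}}) (*-÷-assoc (p ℕ.^ k) l∣m)) ⟩
    h (p ℕ.^ k) * μ²⋆ h m ∎
    where
    p∣l⇒0 : ∀ l → p ∣ℕ l → μ² (p ℕ.* l) * h (p ℕ.* n ÷ (p ℕ.* l)) ≡ + 0
    p∣l⇒0 l (divides q refl) = trans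
      (cong (_* h (p ℕ.* n ÷ (p ℕ.* (q ℕ.* p))))
        (trans (cong (λ t → μ² (p ℕ.* t)) (ℕ.*-comm q p)) (μ²-prime² p-prime q)))
      (ℤ.*-zeroˡ (h (p ℕ.* n ÷ (p ℕ.* (q ℕ.* p)))))
    divisor≢0 : ∀ {l} → l ∣ℕ m → NonZero l
    divisor≢0 {zero} 0∣m = contradiction (ℕ.0∣⇒≡0 0∣m) (ℕ.≢-nonZero⁻¹ m)
    divisor≢0 {suc _} _ = _

μ²⋆-1 : ∀ h → μ²⋆ h 1 ≡ h 1
μ²⋆-1 h = trans (ℤ.+-identityʳ _) (ℤ.*-identityˡ (h 1))

module _ {h : ℕ → ℤ} (h-mult : CompletelyMultiplicative h) (h1≡1 : h 1 ≡ + 1) where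

  μ²⋆-prime-power-value : ∀ {p} → Prime p → ∀ k → μ²⋆ h (p ℕ.^ suc k) ≡ h (p ℕ.^ suc k) + h (p ℕ.^ k)
  μ²⋆-prime-power-value {p} p-prime k = begin
    μ²⋆ h (p ℕ.^ suc k)                                  ≡⟨ cong (μ²⋆ h) (ℕ.*-identityʳ (p ℕ.^ suc k)) ⟨
    μ²⋆ h (p ℕ.^ suc k ℕ.* 1)                            ≡⟨ μ²⋆-prime-power {h} h-mult p-prime p∤1 k ⟩
    (h (p ℕ.^ suc k) + h (p ℕ.^ k)) * μ²⋆ h 1
      ≡⟨ cong ((h (p ℕ.^ suc k) + h (p ℕ.^ k)) *_) (trans (μ²⋆-1 h) h1≡1) ⟩
    (h (p ℕ.^ suc k) + h (p ℕ.^ k)) * + 1                ≡⟨ ℤ.*-identityʳ _ ⟩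
    h (p ℕ.^ suc k) + h (p ℕ.^ k)                        ∎
    where
    open ≡-Reasoning
    p∤1 : ¬ p ∣ℕ 1
    p∤1 p∣1 = ¬prime[1] (subst Prime (ℕ.∣1⇒≡1 p∣1) p-prime)

  μ²⋆-multiplicative : PrimePowerMultiplicative (μ²⋆ h)
  μ²⋆-multiplicative {p} {m} p-prime p∤m k = trans (μ²⋆-prime-power {h} h-mult p-prime p∤m k)
    (cong (_* μ²⋆ h m) (sym (μ²⋆-prime-power-value p-prime k)))

-- The roots of x² + 2bx + c

RootsMod-translate : ∀ {f g n rs} b → (∀ x → g x ≡ f (x + b)) → RootsMod f n rs → RootsMod g n (map (λ r → r - b) rs)
RootsMod-translate {f} {g} b g≡f∘+b R = record
  { incongruent = AllPairs.map⁺ (AllPairs.map (λ {r} {s} r≢s r-b≡s-b →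
      r≢s (≡-mod-≡ (-b+b r b) (-b+b s b) (≡-mod-+ r-b≡s-b (≡-mod-refl b)))) incongruent)
  ; roots = All.map⁺ (All.map (λ {r} fr≡0 →
      ≡-mod-≡ (sym (trans (g≡f∘+b (r - b)) (cong f (-b+b r b)))) refl fr≡0) roots)
  ; complete = λ x gx≡0 → Any.map⁺ (Any.map (λ {r} x+b≡r →
      ≡-mod-≡ (+b-b x b) refl (≡-mod-+ x+b≡r (≡-mod-refl (- b)))) (complete (x + b) (≡-mod-≡ (g≡f∘+b x) refl gx≡0)))
  }
  where
  open RootsMod R
  -b+b : ∀ r b → r - b + b ≡ r
  -b+b = solve-∀
  +b-b : ∀ x b → x + b - b ≡ x
  +b-b = solve-∀

rootCount-1 : ∀ g → rootCount g 1 ≡ 1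
rootCount-1 g = length-filter-upTo (λ m → (+ 1) ∣ℤ? g (+ m)) 1 (0 ∷ []) ([] ∷ [])
  (λ { (here refl) → ℕ.0<1+n , ℕ.1∣ _ })
  (λ { {zero} _ _ → here refl ; {suc _} (s≤s ()) _ })

quadratic : ℤ → ℤ → ℤ → ℤ
quadratic b c x = x * x + + 2 * b * x + c

module Quadratic (b c : ℤ) where

  δ : ℤ
  δ = b * b - c

  quadratic≡norm : ∀ x → quadratic b c x ≡ norm δ (x + b)
  quadratic≡norm x = identity x b c
    where
    identity : ∀ x b c → x * x + + 2 * b * x + c ≡ (x + b) * (x + b) - (b * b - c)
    identity = solve-∀

  quadratic-cong : PreservesCongruence (quadratic b c)
  quadratic-cong {x = x} {y} x≡y = ≡-mod-≡ (sym (quadratic≡norm x)) (sym (quadratic≡norm y))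
    (norm-cong δ (≡-mod-+ x≡y (≡-mod-refl b)))

  rootCount-RootsMod-norm : ∀ {n rs} .{{_ : NonZero n}} → RootsMod (norm δ) n rs → rootCount (quadratic b c) n ≡ length rs
  rootCount-RootsMod-norm {rs = rs} R = trans (rootCount-RootsMod quadratic-cong (RootsMod-translate b quadratic≡norm R))
    (length-map (λ r → r - b) rs)

  rootCount-multiplicative : PrimePowerMultiplicative (λ n → + rootCount (quadratic b c) n)
  rootCount-multiplicative {p} {m} p-prime p∤m k =
    trans (cong +_ (ChineseRemainder.rootCount-* {{p^k+1≢0}} {{m≢0}} p^k+1⊥m quadratic-cong))
      (ℤ.pos-* (rootCount (quadratic b c) (p ℕ.^ suc k)) (rootCount (quadratic b c) m))
    where
    p^k+1≢0 : NonZero (p ℕ.^ suc k)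
    p^k+1≢0 = ℕ.m^n≢0 p (suc k) {{prime⇒nonZero p-prime}}
    m≢0 : NonZero m
    m≢0 = ∤⇒nonZero p∤m
    p^k+1⊥m : Coprime (p ℕ.^ suc k) m
    p^k+1⊥m = coprime-^ (prime∤⇒coprime p-prime p∤m) (suc k)

  rootCount-ramified : ∀ {p r} → Prime p → p ∣ℕ 2 ℕ.* ∣ δ ∣ → + p ∣ + 2 * r → norm δ r ≡ + 0 mod p →
    (∀ y → ¬ norm δ y ≡ + 0 mod p ℕ.* p) →
    ∀ k → + rootCount (quadratic b c) (p ℕ.^ suc k) ≡ χ₀ δ (p ℕ.^ suc k) + χ₀ δ (p ℕ.^ k)
  rootCount-ramified {p} {r} p-prime p∣2δ p∣2r r-root no-root-mod-p² zero = begin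
    + rootCount (quadratic b c) (p ℕ.* 1)
      ≡⟨ cong +_ (rootCount-RootsMod-norm {{p*1≢0}} (RootsMod-single r r-root′ unique)) ⟩
    + 0 + + 1                              ≡⟨ cong₂ _+_ (χ₀-ramified δ p-prime p∣2δ 0) (χ₀-1 δ) ⟨
    χ₀ δ (p ℕ.* 1) + χ₀ δ 1                ∎
    where
    open ≡-Reasoning
    p*1≢0 : NonZero (p ℕ.* 1)
    p*1≢0 = ℕ.m*n≢0 p 1 {{prime⇒nonZero p-prime}}
    p*1≡p : p ℕ.* 1 ≡ p
    p*1≡p = ℕ.*-identityʳ p
    r-root′ : norm δ r ≡ + 0 mod p ℕ.* 1
    r-root′ = subst (norm δ r ≡ + 0 mod_) (sym p*1≡p) r-root
    unique : ∀ y → norm δ y ≡ + 0 mod p ℕ.* 1 → y ≡ r mod p ℕ.* 1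
    unique y y-root = subst (y ≡ r mod_) (sym p*1≡p)
      (root-unique-mod-prime p-prime p∣2r r-root y (subst (norm δ y ≡ + 0 mod_) p*1≡p y-root))
  rootCount-ramified {p} p-prime p∣2δ p∣2r r-root no-root-mod-p² (suc k) = begin
    + rootCount (quadratic b c) (p ℕ.^ suc (suc k))
      ≡⟨ cong +_ (rootCount-RootsMod-norm {{ℕ.m^n≢0 p (suc (suc k)) {{prime⇒nonZero p-prime}}}} (RootsMod-none no-root)) ⟩
    + 0 + + 0
      ≡⟨ cong₂ _+_ (χ₀-ramified δ p-prime p∣2δ (suc k)) (χ₀-ramified δ p-prime p∣2δ k) ⟨
    χ₀ δ (p ℕ.^ suc (suc k)) + χ₀ δ (p ℕ.^ suc k) ∎
    where
    open ≡-Reasoning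
    p²∣p^k+2 : p ℕ.* p ∣ℕ p ℕ.^ suc (suc k)
    p²∣p^k+2 = subst (p ℕ.* p ∣ℕ_) (ℕ.*-assoc p p (p ℕ.^ k)) (ℕ.m∣m*n (p ℕ.^ k))
    no-root : ∀ y → ¬ norm δ y ≡ + 0 mod p ℕ.^ suc (suc k)
    no-root y = no-root-mod-p² y ∘ ≡-mod-∣ p²∣p^k+2

  rootCount-split : ∀ {p r} → Prime p → p ≢ 2 → ¬ + p ∣ δ → norm δ r ≡ + 0 mod p →
    ∀ k → rootCount (quadratic b c) (p ℕ.^ suc k) ≡ 2
  rootCount-split {p} {r} p-prime p≢2 p∤δ r-root k =
    rootCount-RootsMod-norm {{ℕ.m^n≢0 p (suc k) {{prime⇒nonZero p-prime}}}}
      (RootsMod-pair r′ (- r′) r′≢-r′ r′-root -r′-root (roots-±-mod-prime-power (suc k) p-prime p∤2r′ r′-root))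
    where
    r′ : ℤ
    r′ = proj₁ (lift-root {p} {δ} {r} p-prime p≢2 p∤δ r-root k)
    r′-root : norm δ r′ ≡ + 0 mod p ℕ.^ suc k
    r′-root = proj₂ (lift-root {p} {δ} {r} p-prime p≢2 p∤δ r-root k)
    p∤2r′ : ¬ + p ∣ + 2 * r′
    p∤2r′ = unramified⇒∤2r {p} {δ} {r′} p-prime p≢2 p∤δ (≡-mod-∣ (ℕ.m∣m*n (p ℕ.^ k)) r′-root)
    r′≢-r′ : ¬ r′ ≡ - r′ mod p ℕ.^ suc k
    r′≢-r′ = p∤2r′ ∘ ≡-mod-neg⇒∣2* ∘ ≡-mod-∣ (ℕ.m∣m*n (p ℕ.^ k))
    -r′-root : norm δ (- r′) ≡ + 0 mod p ℕ.^ suc k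
    -r′-root = ≡-mod-≡ (cong (_- δ) (neg*neg r′)) refl r′-root
      where
      neg*neg : ∀ r → r * r ≡ - r * - r
      neg*neg = solve-∀

  rootCount-inert : ∀ {p} .{{_ : NonZero p}} → (∀ y → ¬ norm δ y ≡ + 0 mod p) →
    ∀ k → rootCount (quadratic b c) (p ℕ.^ suc k) ≡ 0
  rootCount-inert {p} no-root k = rootCount-RootsMod-norm {{ℕ.m^n≢0 p (suc k)}}
    (RootsMod-none (λ y → no-root y ∘ ≡-mod-∣ (ℕ.m∣m*n (p ℕ.^ k))))

  module _ (δ-squarefree : SquareFree δ) (4∤δ-1 : ¬ + 4 ∣ δ - + 1) where

    rootCount-prime-power : ∀ {p} → Prime p →
      ∀ k → + rootCount (quadratic b c) (p ℕ.^ suc k) ≡ χ₀ δ (p ℕ.^ suc k) + χ₀ δ (p ℕ.^ k)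
    rootCount-prime-power {p} p-prime k with (+ p) ∣ℤ? δ
    ... | yes p∣δ = rootCount-ramified {r = + 0} p-prime (ℕ.∣n⇒∣m*n 2 p∣δ) (p ℕ.∣0) 0-root
          (squareFree⇒no-root-mod-p² δ-squarefree p-prime p∣δ) k
      where
      0-root : norm δ (+ 0) ≡ + 0 mod p
      0-root = ≡-mod-≡ (sym (ℤ.+-identityˡ (- δ))) refl
        (∣⇒≡-mod-0 (subst (p ∣ℕ_) (sym (ℤ.∣-i∣≡∣i∣ δ)) p∣δ))
    ... | no p∤δ with p ℕ.≟ 2
    ...   | yes refl =
      rootCount-ramified {r = + 1} prime[2] (ℕ.m∣m*n ∣ δ ∣) (ℕ.∣-refl {2}) 1-root (no-root-mod-4 p∤δ 4∤δ-1) k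
      where
      1-root : norm δ (+ 1) ≡ + 0 mod 2
      1-root = square≡⇒norm≡0 {δ} {2} {+ 1} (≡-mod-sym (odd⇒≡1-mod-2 p∤δ))
    ...   | no p≢2 with legendre-cases {{prime⇒nonZero p-prime}} p∤δ
    ...     | inj₁ (legendre≡1 , r , r-root) = begin
      + rootCount (quadratic b c) (p ℕ.^ suc k)    ≡⟨ cong +_ (rootCount-split {r = r} p-prime p≢2 p∤δ r-root k) ⟩
      + 1 + + 1                                    ≡⟨ cong₂ _+_ (ℤ.^-zeroˡ (suc k)) (ℤ.^-zeroˡ k) ⟨
      (+ 1) ℤ.^ suc k + (+ 1) ℤ.^ k                ≡⟨ cong (λ t → t ℤ.^ suc k + t ℤ.^ k) legendre≡1 ⟨
      legendre δ p ℤ.^ suc k + legendre δ p ℤ.^ k  ≡⟨ χ₀-local-factor δ p-prime p≢2 p∤δ k ⟨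
      χ₀ δ (p ℕ.^ suc k) + χ₀ δ (p ℕ.^ k)          ∎
      where open ≡-Reasoning
    ...     | inj₂ (legendre≡-1 , no-root) = begin
      + rootCount (quadratic b c) (p ℕ.^ suc k)    ≡⟨ cong +_ (rootCount-inert {{prime⇒nonZero p-prime}} no-root k) ⟩
      + 0                                          ≡⟨ -1^[k+1]+-1^k≡0 k ⟨
      (- + 1) ℤ.^ suc k + (- + 1) ℤ.^ k            ≡⟨ cong (λ t → t ℤ.^ suc k + t ℤ.^ k) legendre≡-1 ⟨
      legendre δ p ℤ.^ suc k + legendre δ p ℤ.^ k  ≡⟨ χ₀-local-factor δ p-prime p≢2 p∤δ k ⟨
      χ₀ δ (p ℕ.^ suc k) + χ₀ δ (p ℕ.^ k)          ∎
      where
      open ≡-Reasoning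
      -1^[k+1]+-1^k≡0 : ∀ k → (- + 1) ℤ.^ suc k + (- + 1) ℤ.^ k ≡ + 0
      -1^[k+1]+-1^k≡0 k = trans (cong (_+ (- + 1) ℤ.^ k) (ℤ.-1*i≡-i ((- + 1) ℤ.^ k))) (ℤ.+-inverseˡ ((- + 1) ℤ.^ k))

    ρ≡μ²⋆χ₀ : ∀ d .{{_ : NonZero d}} → + ρ b c d ≡ μ²⋆ (χ₀ δ) d
    ρ≡μ²⋆χ₀ = primePower-determined rootCount-multiplicative (μ²⋆-multiplicative {χ₀ δ} (χ₀-* δ) (χ₀-1 δ))
      (trans (cong +_ (rootCount-1 (quadratic b c))) (sym (trans (μ²⋆-1 (χ₀ δ)) (χ₀-1 δ))))
      (λ p-prime k → trans (rootCount-prime-power p-prime k)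
        (sym (μ²⋆-prime-power-value {χ₀ δ} (χ₀-* δ) (χ₀-1 δ) p-prime k)))

-- Sums over factor pairs

FactorPairFunction : Set
FactorPairFunction = (l m : ℕ) → .{{NonZero l}} → .{{NonZero m}} → ℤ

-- The summand of sumOverFactorPairs is local to its where block; unification gives it a name.
mutual
  factorPairTerm : ℕ → FactorPairFunction → ℕ → ℕ → ℤ
  factorPairTerm = _

  sumOverFactorPairs-unfold : ∀ d f →
    sumOverFactorPairs d f ≡ sumℤ (concatMap (λ i → map (factorPairTerm d f i) (upTo d)) (upTo d))
  sumOverFactorPairs-unfold d f = refl

factorPairTerm-≡ : ∀ d f i j → suc i ℕ.* suc j ≡ d → factorPairTerm d f i j ≡ f (suc i) (suc j)
factorPairTerm-≡ d f i j ij≡d with suc i ℕ.* suc j ℕ.≟ d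
... | yes _ = refl
... | no ij≢d = contradiction ij≡d ij≢d

factorPairTerm-≢ : ∀ d f i j → suc i ℕ.* suc j ≢ d → factorPairTerm d f i j ≡ + 0
factorPairTerm-≢ d f i j ij≢d with suc i ℕ.* suc j ℕ.≟ d
... | yes ij≡d = contradiction ij≡d ij≢d
... | no _ = refl

module _ (d : ℕ) .{{_ : NonZero d}} (f : FactorPairFunction) (F : ℕ → ℕ → ℤ)
         (f≗F : ∀ l m → f (suc l) (suc m) ≡ F (suc l) (suc m)) where

  divisorTerm : ℕ → ℤ
  divisorTerm l = if does (l ℕ.∣? d) then F l (d ÷ l) else + 0

  divisorTerm-∣ : ∀ {l} → l ∣ℕ d → divisorTerm l ≡ F l (d ÷ l)
  divisorTerm-∣ {l} l∣d = cong (if_then F l (d ÷ l) else + 0) (dec-true (l ℕ.∣? d) l∣d)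

  divisorTerm-∤ : ∀ {l} → ¬ l ∣ℕ d → divisorTerm l ≡ + 0
  divisorTerm-∤ {l} l∤d = cong (if_then F l (d ÷ l) else + 0) (dec-false (l ℕ.∣? d) l∤d)

  factorPairRow : ∀ i → sumℤ (map (factorPairTerm d f i) (upTo d)) ≡ divisorTerm (suc i)
  factorPairRow i = by-cases (suc i ℕ.∣? d)
    where
    by-cases : Dec (suc i ∣ℕ d) → sumℤ (map (factorPairTerm d f i) (upTo d)) ≡ divisorTerm (suc i)
    by-cases (no i+1∤d) = trans (sumℤ-map-zero _ (upTo d) (λ {j} _ → factorPairTerm-≢ d f i j
        (λ ij≡d → i+1∤d (divides (suc j) (trans (sym ij≡d) (ℕ.*-comm (suc i) (suc j)))))))
      (sym (divisorTerm-∤ i+1∤d))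
    by-cases (yes (divides zero d≡0)) = contradiction d≡0 (ℕ.≢-nonZero⁻¹ d)
    by-cases (yes i+1∣d@(divides (suc j) d≡[j+1][i+1])) = begin
      sumℤ (map (factorPairTerm d f i) (upTo d))    ≡⟨ sumℤ-map-single _ (Unique.upTo⁺ d) (∈-upTo⁺ j<d) others ⟩
      factorPairTerm d f i j                        ≡⟨ factorPairTerm-≡ d f i j [i+1][j+1]≡d ⟩
      f (suc i) (suc j)                             ≡⟨ f≗F i j ⟩
      F (suc i) (suc j)                             ≡⟨ cong (F (suc i)) d÷[i+1]≡j+1 ⟨
      F (suc i) (d ÷ suc i)                         ≡⟨ divisorTerm-∣ i+1∣d ⟨
      divisorTerm (suc i)                           ∎
      where
      open ≡-Reasoning
      [i+1][j+1]≡d : suc i ℕ.* suc j ≡ d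
      [i+1][j+1]≡d = trans (ℕ.*-comm (suc i) (suc j)) (sym d≡[j+1][i+1])
      j<d : j < d
      j<d = subst (suc j ≤_) (sym d≡[j+1][i+1]) (ℕ.m≤m*n (suc j) (suc i))
      d÷[i+1]≡j+1 : d ÷ suc i ≡ suc j
      d÷[i+1]≡j+1 = trans (cong (_÷ suc i) d≡[j+1][i+1]) (m*n/n≡m (suc j) (suc i))
      others : ∀ {k} → k ∈ upTo d → k ≢ j → factorPairTerm d f i k ≡ + 0
      others {k} _ k≢j = factorPairTerm-≢ d f i k (λ ik≡d → k≢j (ℕ.suc-injective
        (ℕ.*-cancelˡ-≡ (suc k) (suc j) (suc i) (trans ik≡d (sym [i+1][j+1]≡d)))))

  sumOverFactorPairs≡divisorSum : sumOverFactorPairs d f ≡ divisorSum d (λ l → F l (d ÷ l))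
  sumOverFactorPairs≡divisorSum = begin
    sumOverFactorPairs d f
      ≡⟨ sumOverFactorPairs-unfold d f ⟩
    sumℤ (concatMap (λ i → map (factorPairTerm d f i) (upTo d)) (upTo d))
      ≡⟨ sumℤ-concatMap (λ i → map (factorPairTerm d f i) (upTo d)) (upTo d) ⟩
    sumℤ (map (λ i → sumℤ (map (factorPairTerm d f i) (upTo d))) (upTo d))
      ≡⟨ sumℤ-map-cong (upTo d) (λ {i} _ → factorPairRow i) ⟩
    sumℤ (map (divisorTerm ∘ suc) (upTo d))
      ≡⟨ cong sumℤ (map-∘ (upTo d)) ⟩
    sumℤ (map divisorTerm (map suc (upTo d)))
      ≡⟨ sumℤ-map-filter (ℕ._∣? d) (λ l → F l (d ÷ l)) (map suc (upTo d)) ⟨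
    divisorSum d (λ l → F l (d ÷ l))
      ∎
    where open ≡-Reasoning

lemma2p1 : (b c : ℤ) → SquareFree (b * b - c) → ¬ ((+ 4) ∣ ((b * b - c) - + 1)) →
    (d : ℕ) → .{{_ : NonZero d}} →
    + ρ b c d ≡ sumOverFactorPairs d (λ l m → möbius l * möbius l * χ (b * b - c) m)
lemma2p1 b c δ-squarefree 4∤δ-1 d = begin
  + ρ b c d
    ≡⟨ ρ≡μ²⋆χ₀ δ-squarefree 4∤δ-1 d ⟩
  μ²⋆ (χ₀ δ) d
    ≡⟨ sumOverFactorPairs≡divisorSum d _ (λ l m → μ² l * χ₀ δ m) (λ _ _ → refl) ⟨
  sumOverFactorPairs d (λ l m → möbius l * möbius l * χ δ m)
    ∎
  where
  open ≡-Reasoning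
  open Quadratic b c
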